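{- Let $i,k,m$ be positive integers with $k\geqslant 2$ and $i\cdot\mathrm{rad}(i)\mid m$, and suppose $i=p_1^{\alpha_1}p_2^{\alpha_2}\cdots p_s^{\alpha_s}$ with $s\in\mathbb{N}_+$, distinct primes $p_1,\ldots,p_s$ and positive integers $\alpha_1,\ldots,\alpha_s$. Then \[ r_\mathcal{M}(i,m,k)=m\,\varphi^{k-2}(m)\prod_{j=1}^{s}\binom{\alpha_j+k-2}{\alpha_j}, \] where $\varphi$ is Euler's totient function and $\varphi^{k-2}(m)$ denotes $(\varphi(m))^{k-2}$.
   Context: $\mathbb{N}=\{0,1,2,\ldots\}$. For a positive integer $i$ with distinct prime divisors $p_1,\ldots,p_s$, $\mathrm{rad}(i)=p_1\cdots p_s$. Let $\mathcal{M}=(m^{j-1})_{j\in\mathbb{N}_+}$ and let $p_\mathcal{M}(n,k)$ be the number of tuples $(x_1,\ldots,x_k)\in\mathbb{N}^k$ with $x_1+mx_2+\cdots+m^{k-1}x_k=n$. For integers $k\ge1$ and $i$, define $r_\mathcal{M}(i,m,k)=\#\{n\in\{0,1,\ldots,m^k-1\}:\ p_\mathcal{M}(n,k)\equiv i\pmod{m}\}$. -}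

module Defs where

open import Data.Nat using (ℕ; zero; suc; _+_; _*_; _∸_; _^_; _≤_; _<_; NonZero)
open import Data.Nat.Properties using (_≟_; _≤?_)
open import Data.Nat.DivMod using (_%_)
open import Data.Nat.GCD using (gcd)
open import Data.Nat.Divisibility using (_∣?_)
open import Data.Nat.Primality using (prime?)
open import Data.List using (List; []; _∷_; upTo; map; filter; length)
open import Data.Nat.ListAction using (sum; product)
open import Relation.Nullary using (yes; no)
open import Relation.Nullary.Decidable using (_×-dec_)

Σ≤ : ℕ → (ℕ → ℕ) → ℕ
Σ≤ n f = sum (map f (upTo (suc n)))

-- Number of tuples (x₁,…,x_k) ∈ ℕ^k with w₁x₁ + … + w_k x_k = n,
-- for the weight list ws = [w₁,…,w_k] with all wⱼ ≥ 1
-- (counted by splitting on the first coordinate x₁ ∈ {0,…,n}).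
countTuples : List ℕ → ℕ → ℕ
countTuples [] n with n ≟ 0
... | yes _ = 1
... | no _ = 0
countTuples (w ∷ ws) n = Σ≤ n (λ x → step x)
  where
  step : ℕ → ℕ
  step x with w * x ≤? n
  ... | yes _ = countTuples ws (n ∸ w * x)
  ... | no _ = 0

weights : ℕ → ℕ → List ℕ
weights m k = map (m ^_) (upTo k)

pM : ℕ → ℕ → ℕ → ℕ
pM m n k = countTuples (weights m k) n

rM : ℕ → (m : ℕ) → .{{NonZero m}} → ℕ → ℕ
rM i m k = length (filter (λ n → pM m n k % m ≟ i % m) (upTo (m ^ k)))

φ : ℕ → ℕ
φ m = length (filter (λ j → gcd (suc j) m ≟ 1) (upTo m))

rad : ℕ → ℕ
rad i = product (filter (λ p → prime? p ×-dec (p ∣? i)) (upTo (suc i)))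

-- Splitting off the largest part m^(k-1) gives p(n,k) = Σ_{x ≤ n / m^(k-1)} p(n - x m^(k-1), k-1),
-- and p(·,k-1) is periodic modulo m with period m^(k-1); hence
-- p(a m^(k-1) + r, k) ≡ (a + 1) p(r, k-1) (mod m) for r < m^(k-1).  Counting the n < m^k by
-- this formula shows that r_M(i,m,k) is m times the number N_{k-2}(i) of (k-1)-tuples of residues
-- modulo m with product ≡ i.  When i rad(i) ∣ m, the congruence u x ≡ i has gcd(u,m) solutions
-- x if gcd(u,m) ∣ i, all with gcd(x,m) = i / gcd(u,m), and there are φ(m) / d residues u with
-- gcd(u,m) = d; so N_{s+1}(i) = φ(m) Σ_{d ∣ i} N_s(i/d).  Over the factorisation i = ∏ pⱼ^αⱼ this
-- divisor sum splits prime by prime, and the hockey-stick identity yields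
-- N_s(i) = φ(m)^s ∏ C(αⱼ + s, αⱼ).

module Submission where

open import Defs
open import Data.Nat using (ℕ; _*_; _+_; _∸_; _^_; _≤_; _<_; NonZero)
open import Data.Nat.Divisibility using (_∣_)
open import Data.Nat.Primality using (Prime)
open import Data.Nat.Combinatorics using (_C_)
open import Data.Product using (_×_; proj₁; proj₂)
open import Data.List using (List; map; length)
open import Data.Nat.ListAction using (product)
open import Data.List.Relation.Unary.All using (All)
open import Data.List.Relation.Unary.Unique.Propositional using (Unique)
open import Relation.Binary.PropositionalEquality using (_≡_)

module FiniteSums where

  open import Data.Nat
  open import Data.Nat.Properties
  open import Data.List using (upTo; applyUpTo; map; filter; length)
  open import Data.Nat.ListAction using (sum)
  open import Relation.Binary.PropositionalEquality
  open import Relation.Nullary using (Dec; yes; no; ¬_)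
  open import Relation.Unary using (Pred; Decidable)
  open import Data.Empty using (⊥-elim)
  open import Function using (_∘_)
  open import Algebra.Properties.CommutativeSemigroup +-commutativeSemigroup using (interchange)
  open ≡-Reasoning

  ∑< : ℕ → (ℕ → ℕ) → ℕ
  ∑< zero    f = 0
  ∑< (suc n) f = ∑< n f + f n

  𝟙 : ∀ {P : Set} → Dec P → ℕ
  𝟙 (yes _) = 1
  𝟙 (no _)  = 0

  𝟙-yes : ∀ {P : Set} (P? : Dec P) → P → 𝟙 P? ≡ 1
  𝟙-yes (yes _) _ = refl
  𝟙-yes (no ¬p) p = ⊥-elim (¬p p)

  𝟙-no : ∀ {P : Set} (P? : Dec P) → ¬ P → 𝟙 P? ≡ 0
  𝟙-no (yes p) ¬p = ⊥-elim (¬p p)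
  𝟙-no (no _)  _  = refl

  𝟙-cong : ∀ {P Q : Set} (P? : Dec P) (Q? : Dec Q) → (P → Q) → (Q → P) → 𝟙 P? ≡ 𝟙 Q?
  𝟙-cong (yes p) Q? f g = sym (𝟙-yes Q? (f p))
  𝟙-cong (no ¬p) Q? f g = sym (𝟙-no Q? (¬p ∘ g))

  𝟙*-cong : ∀ {P : Set} (P? : Dec P) {a b} → (P → a ≡ b) → 𝟙 P? * a ≡ 𝟙 P? * b
  𝟙*-cong (yes p) eq = cong (1 *_) (eq p)
  𝟙*-cong (no _)  _  = refl

  ∑<-cong-< : ∀ n {f g : ℕ → ℕ} → (∀ x → x < n → f x ≡ g x) → ∑< n f ≡ ∑< n g
  ∑<-cong-< zero    eq = refl
  ∑<-cong-< (suc n) eq = cong₂ _+_ (∑<-cong-< n (λ x x<n → eq x (m<n⇒m<1+n x<n))) (eq n ≤-refl)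

  ∑<-cong : ∀ n {f g : ℕ → ℕ} → (∀ x → f x ≡ g x) → ∑< n f ≡ ∑< n g
  ∑<-cong n eq = ∑<-cong-< n (λ x _ → eq x)

  ∑<-≡0 : ∀ n {f : ℕ → ℕ} → (∀ x → x < n → f x ≡ 0) → ∑< n f ≡ 0
  ∑<-≡0 zero    _  = refl
  ∑<-≡0 (suc n) eq = cong₂ _+_ (∑<-≡0 n (λ x x<n → eq x (m<n⇒m<1+n x<n))) (eq n ≤-refl)

  ∑<-distrib-+ : ∀ n (f g : ℕ → ℕ) → ∑< n (λ x → f x + g x) ≡ ∑< n f + ∑< n g
  ∑<-distrib-+ zero    f g = refl
  ∑<-distrib-+ (suc n) f g = begin
    ∑< n (λ x → f x + g x) + (f n + g n) ≡⟨ cong (_+ (f n + g n)) (∑<-distrib-+ n f g) ⟩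
    ∑< n f + ∑< n g + (f n + g n)        ≡⟨ interchange (∑< n f) (∑< n g) (f n) (g n) ⟩
    ∑< n f + f n + (∑< n g + g n)        ∎

  ∑<-*ˡ : ∀ n c (f : ℕ → ℕ) → ∑< n (λ x → c * f x) ≡ c * ∑< n f
  ∑<-*ˡ zero    c f = sym (*-zeroʳ c)
  ∑<-*ˡ (suc n) c f = trans (cong (_+ c * f n) (∑<-*ˡ n c f)) (sym (*-distribˡ-+ c (∑< n f) (f n)))

  ∑<-*ʳ : ∀ n c (f : ℕ → ℕ) → ∑< n (λ x → f x * c) ≡ ∑< n f * c
  ∑<-*ʳ n c f = trans (∑<-cong n (λ x → *-comm (f x) c)) (trans (∑<-*ˡ n c f) (*-comm c _))

  ∑<-const : ∀ n c → ∑< n (λ _ → c) ≡ n * c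
  ∑<-const zero    c = refl
  ∑<-const (suc n) c = trans (cong (_+ c) (∑<-const n c)) (+-comm (n * c) c)

  ∑<-+ : ∀ a b (f : ℕ → ℕ) → ∑< (a + b) f ≡ ∑< a f + ∑< b (λ x → f (a + x))
  ∑<-+ a zero    f = trans (cong (λ n → ∑< n f) (+-identityʳ a)) (sym (+-identityʳ _))
  ∑<-+ a (suc b) f = begin
    ∑< (a + suc b) f                                  ≡⟨ cong (λ n → ∑< n f) (+-suc a b) ⟩
    ∑< (a + b) f + f (a + b)                          ≡⟨ cong (_+ f (a + b)) (∑<-+ a b f) ⟩
    ∑< a f + ∑< b (λ x → f (a + x)) + f (a + b)       ≡⟨ +-assoc (∑< a f) _ _ ⟩
    ∑< a f + (∑< b (λ x → f (a + x)) + f (a + b))     ∎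

  ∑<-suc : ∀ n (f : ℕ → ℕ) → ∑< (suc n) f ≡ f 0 + ∑< n (f ∘ suc)
  ∑<-suc n f = ∑<-+ 1 n f

  ∑<-reverse : ∀ n (f : ℕ → ℕ) → ∑< (suc n) (λ x → f (n ∸ x)) ≡ ∑< (suc n) f
  ∑<-reverse zero    f = refl
  ∑<-reverse (suc n) f = begin
    ∑< (suc (suc n)) (λ x → f (suc n ∸ x))   ≡⟨ ∑<-suc (suc n) _ ⟩
    f (suc n) + ∑< (suc n) (λ x → f (n ∸ x)) ≡⟨ cong (f (suc n) +_) (∑<-reverse n f) ⟩
    f (suc n) + ∑< (suc n) f                 ≡⟨ +-comm (f (suc n)) _ ⟩
    ∑< (suc (suc n)) f                       ∎

  ∑<-swap : ∀ a b (f : ℕ → ℕ → ℕ) → ∑< a (λ x → ∑< b (f x)) ≡ ∑< b (λ y → ∑< a (λ x → f x y))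
  ∑<-swap zero    b f = sym (∑<-≡0 b (λ _ _ → refl))
  ∑<-swap (suc a) b f = begin
    ∑< a (λ x → ∑< b (f x)) + ∑< b (f a)            ≡⟨ cong (_+ ∑< b (f a)) (∑<-swap a b f) ⟩
    ∑< b (λ y → ∑< a (λ x → f x y)) + ∑< b (f a)    ≡⟨ ∑<-distrib-+ b _ _ ⟨
    ∑< b (λ y → ∑< a (λ x → f x y) + f a y)         ∎

  ∑<-blocks : ∀ a M (f : ℕ → ℕ) → ∑< (a * M) f ≡ ∑< a (λ q → ∑< M (λ r → f (q * M + r)))
  ∑<-blocks zero    M f = refl
  ∑<-blocks (suc a) M f = begin
    ∑< (M + a * M) f                                         ≡⟨ cong (λ n → ∑< n f) (+-comm M (a * M)) ⟩
    ∑< (a * M + M) f                                         ≡⟨ ∑<-+ (a * M) M f ⟩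
    ∑< (a * M) f + ∑< M (λ r → f (a * M + r))                ≡⟨ cong (_+ ∑< M (λ r → f (a * M + r))) (∑<-blocks a M f) ⟩
    ∑< a (λ q → ∑< M (λ r → f (q * M + r))) + ∑< M (λ r → f (a * M + r)) ∎

  ∑<-periodic : ∀ a M (f : ℕ → ℕ) → (∀ q r → r < M → f (q * M + r) ≡ f r) → ∑< (a * M) f ≡ a * ∑< M f
  ∑<-periodic a M f per = begin
    ∑< (a * M) f                              ≡⟨ ∑<-blocks a M f ⟩
    ∑< a (λ q → ∑< M (λ r → f (q * M + r)))   ≡⟨ ∑<-cong a (λ q → ∑<-cong-< M (per q)) ⟩
    ∑< a (λ _ → ∑< M f)                       ≡⟨ ∑<-const a _ ⟩
    a * ∑< M f                                ∎

  ∑<-point : ∀ n x₀ (f : ℕ → ℕ) → x₀ < n → (∀ x → x < n → x ≢ x₀ → f x ≡ 0) → ∑< n f ≡ f x₀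
  ∑<-point (suc n) x₀ f x₀<1+n vanish with x₀ ≟ n
  ... | yes refl = cong (_+ f n) (∑<-≡0 n (λ x x<n → vanish x (m<n⇒m<1+n x<n) (<⇒≢ x<n)))
  ... | no x₀≢n  = begin
    ∑< n f + f n ≡⟨ cong (∑< n f +_) (vanish n ≤-refl (x₀≢n ∘ sym)) ⟩
    ∑< n f + 0   ≡⟨ +-identityʳ _ ⟩
    ∑< n f       ≡⟨ ∑<-point n x₀ f (≤∧≢⇒< (≤-pred x₀<1+n) x₀≢n) (λ x x<n → vanish x (m<n⇒m<1+n x<n)) ⟩
    f x₀         ∎

  ∑<-extend : ∀ n N (f : ℕ → ℕ) → n ≤ N → (∀ x → n ≤ x → f x ≡ 0) → ∑< N f ≡ ∑< n f
  ∑<-extend n N f n≤N vanish = begin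
    ∑< N f                                     ≡⟨ cong (λ k → ∑< k f) (m+[n∸m]≡n n≤N) ⟨
    ∑< (n + (N ∸ n)) f                         ≡⟨ ∑<-+ n (N ∸ n) f ⟩
    ∑< n f + ∑< (N ∸ n) (λ x → f (n + x))      ≡⟨ cong (∑< n f +_) (∑<-≡0 (N ∸ n) (λ x _ → vanish (n + x) (m≤m+n n x))) ⟩
    ∑< n f + 0                                 ≡⟨ +-identityʳ _ ⟩
    ∑< n f                                     ∎

  ∑<-fibres : ∀ n B (g : ℕ → ℕ) (h : ℕ → ℕ) → (∀ x → x < n → g x < B) →
    ∑< n (h ∘ g) ≡ ∑< B (λ d → h d * ∑< n (λ x → 𝟙 (g x ≟ d)))
  ∑<-fibres n B g h g<B = begin
    ∑< n (h ∘ g)                                      ≡⟨ ∑<-cong-< n (λ x x<n → fibre x (g<B x x<n)) ⟨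
    ∑< n (λ x → ∑< B (λ d → h d * 𝟙 (g x ≟ d)))       ≡⟨ ∑<-swap n B _ ⟩
    ∑< B (λ d → ∑< n (λ x → h d * 𝟙 (g x ≟ d)))       ≡⟨ ∑<-cong B (λ d → ∑<-*ˡ n (h d) _) ⟩
    ∑< B (λ d → h d * ∑< n (λ x → 𝟙 (g x ≟ d)))       ∎
    where
    fibre : ∀ x → g x < B → ∑< B (λ d → h d * 𝟙 (g x ≟ d)) ≡ h (g x)
    fibre x gx<B = begin
      ∑< B (λ d → h d * 𝟙 (g x ≟ d))   ≡⟨ ∑<-point B (g x) _ gx<B off-fibre ⟩
      h (g x) * 𝟙 (g x ≟ g x)          ≡⟨ cong (h (g x) *_) (𝟙-yes (g x ≟ g x) refl) ⟩
      h (g x) * 1                      ≡⟨ *-identityʳ _ ⟩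
      h (g x)                          ∎
      where
      off-fibre : ∀ d → d < B → d ≢ g x → h d * 𝟙 (g x ≟ d) ≡ 0
      off-fibre d _ d≢gx = trans (cong (h d *_) (𝟙-no (g x ≟ d) (d≢gx ∘ sym))) (*-zeroʳ (h d))

  ∑<-rotate : ∀ n (f : ℕ → ℕ) → f n ≡ f 0 → ∑< n (f ∘ suc) ≡ ∑< n f
  ∑<-rotate n f fn≡f0 = +-cancelˡ-≡ (f 0) _ _ (begin
    f 0 + ∑< n (f ∘ suc) ≡⟨ ∑<-suc n f ⟨
    ∑< n f + f n         ≡⟨ cong (∑< n f +_) fn≡f0 ⟩
    ∑< n f + f 0         ≡⟨ +-comm (∑< n f) (f 0) ⟩
    f 0 + ∑< n f         ∎)

  sum-map-upTo : ∀ n (f : ℕ → ℕ) → sum (map f (upTo n)) ≡ ∑< n f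
  sum-map-upTo n f = go n (λ x → x)
    where
    go : ∀ n (g : ℕ → ℕ) → sum (map f (applyUpTo g n)) ≡ ∑< n (f ∘ g)
    go zero    g = refl
    go (suc n) g = trans (cong (f (g 0) +_) (go n (g ∘ suc))) (sym (∑<-suc n (f ∘ g)))

  length-filter-upTo : ∀ {P : Pred ℕ _} (P? : Decidable P) n → length (filter P? (upTo n)) ≡ ∑< n (𝟙 ∘ P?)
  length-filter-upTo P? n = go n (λ x → x)
    where
    go : ∀ n (g : ℕ → ℕ) → length (filter P? (applyUpTo g n)) ≡ ∑< n (𝟙 ∘ P? ∘ g)
    go zero    g = refl
    go (suc n) g = trans first (sym (∑<-suc n (𝟙 ∘ P? ∘ g)))
      where
      first : length (filter P? (applyUpTo g (suc n))) ≡ 𝟙 (P? (g 0)) + ∑< n (𝟙 ∘ P? ∘ g ∘ suc)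
      first with P? (g 0)
      ... | yes _ = cong suc (go n (g ∘ suc))
      ... | no _  = go n (g ∘ suc)

module CountTuples where

  open FiniteSums
  open import Data.Nat
  open import Data.Nat.Properties
  open import Data.List using (List; []; _∷_; _∷ʳ_; upTo)
  open import Data.List.Properties using (map-cong)
  open import Data.Nat.ListAction using (sum)
  open import Data.List.Relation.Unary.All using (All; []; _∷_)
  open import Relation.Binary.PropositionalEquality
  open import Relation.Nullary using (yes; no)
  open import Data.Empty using (⊥-elim)
  open ≡-Reasoning

  sumOverMultiples : ℕ → ℕ → (ℕ → ℕ) → ℕ
  sumOverMultiples w n f = ∑< (suc n) (λ x → 𝟙 (w * x ≤? n) * f (n ∸ w * x))

  sumOverMultiples-cong : ∀ w n {f g : ℕ → ℕ} → (∀ n′ → f n′ ≡ g n′) →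
    sumOverMultiples w n f ≡ sumOverMultiples w n g
  sumOverMultiples-cong w n eq = ∑<-cong (suc n) (λ x → cong (𝟙 (w * x ≤? n) *_) (eq (n ∸ w * x)))

  sumOverMultiples-extend : ∀ w n N (f : ℕ → ℕ) → 1 ≤ w → n ≤ N →
    ∑< (suc N) (λ x → 𝟙 (w * x ≤? n) * f (n ∸ w * x)) ≡ sumOverMultiples w n f
  sumOverMultiples-extend w@(suc _) n N f _ n≤N = ∑<-extend (suc n) (suc N) _ (s≤s n≤N)
    (λ x n<x → cong (_* f (n ∸ w * x)) (𝟙-no (w * x ≤? n) (<⇒≱ (<-≤-trans n<x (m≤n*m x w)))))

  𝟙-≤-∸ : ∀ a b n → 𝟙 (a ≤? n) * 𝟙 (b ≤? n ∸ a) ≡ 𝟙 (a + b ≤? n)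
  𝟙-≤-∸ a b n with a ≤? n | b ≤? n ∸ a | a + b ≤? n
  ... | yes a≤n | yes b≤n∸a | no a+b≰n = ⊥-elim (a+b≰n (subst (a + b ≤_) (m+[n∸m]≡n a≤n) (+-monoʳ-≤ a b≤n∸a)))
  ... | yes _   | no b≰n∸a  | yes a+b≤n = ⊥-elim (b≰n∸a (subst (_≤ n ∸ a) (m+n∸m≡n a b) (∸-monoˡ-≤ a a+b≤n)))
  ... | no a≰n  | _         | yes a+b≤n = ⊥-elim (a≰n (≤-trans (m≤m+n a b) a+b≤n))
  ... | yes _   | yes _     | yes _ = refl
  ... | yes _   | no _      | no _  = refl
  ... | no _    | _         | no _  = refl

  sumOverMultiples-comm : ∀ v w n (f : ℕ → ℕ) → 1 ≤ v → 1 ≤ w →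
    sumOverMultiples v n (λ n′ → sumOverMultiples w n′ f) ≡ sumOverMultiples w n (λ n′ → sumOverMultiples v n′ f)
  sumOverMultiples-comm v w n f 1≤v 1≤w = begin
    sumOverMultiples v n (λ n′ → sumOverMultiples w n′ f)
      ≡⟨ ∑<-cong (suc n) (λ y → cong (𝟙 (v * y ≤? n) *_) (sym (sumOverMultiples-extend w _ n f 1≤w (m∸n≤m n (v * y))))) ⟩
    ∑< (suc n) (λ y → 𝟙 (v * y ≤? n) * ∑< (suc n) (λ x → 𝟙 (w * x ≤? n ∸ v * y) * f (n ∸ v * y ∸ w * x)))
      ≡⟨ ∑<-cong (suc n) (λ y → sym (∑<-*ˡ (suc n) (𝟙 (v * y ≤? n)) (λ x → 𝟙 (w * x ≤? n ∸ v * y) * f (n ∸ v * y ∸ w * x)))) ⟩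
    ∑< (suc n) (λ y → ∑< (suc n) (λ x → term (v * y) (w * x)))
      ≡⟨ ∑<-swap (suc n) (suc n) (λ y x → term (v * y) (w * x)) ⟩
    ∑< (suc n) (λ x → ∑< (suc n) (λ y → term (v * y) (w * x)))
      ≡⟨ ∑<-cong (suc n) (λ x → ∑<-cong (suc n) (λ y → term-comm (v * y) (w * x))) ⟩
    ∑< (suc n) (λ x → ∑< (suc n) (λ y → term (w * x) (v * y)))
      ≡⟨ ∑<-cong (suc n) (λ x → ∑<-*ˡ (suc n) (𝟙 (w * x ≤? n)) (λ y → 𝟙 (v * y ≤? n ∸ w * x) * f (n ∸ w * x ∸ v * y))) ⟩
    ∑< (suc n) (λ x → 𝟙 (w * x ≤? n) * ∑< (suc n) (λ y → 𝟙 (v * y ≤? n ∸ w * x) * f (n ∸ w * x ∸ v * y)))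
      ≡⟨ ∑<-cong (suc n) (λ x → cong (𝟙 (w * x ≤? n) *_) (sumOverMultiples-extend v _ n f 1≤v (m∸n≤m n (w * x)))) ⟩
    sumOverMultiples w n (λ n′ → sumOverMultiples v n′ f) ∎
    where
    term : ℕ → ℕ → ℕ
    term a b = 𝟙 (a ≤? n) * (𝟙 (b ≤? n ∸ a) * f (n ∸ a ∸ b))
    term≡ : ∀ a b → term a b ≡ 𝟙 (a + b ≤? n) * f (n ∸ (a + b))
    term≡ a b = trans (sym (*-assoc (𝟙 (a ≤? n)) _ _)) (cong₂ _*_ (𝟙-≤-∸ a b n) (cong f (∸-+-assoc n a b)))
    term-comm : ∀ a b → term a b ≡ term b a
    term-comm a b = begin
      term a b                         ≡⟨ term≡ a b ⟩
      𝟙 (a + b ≤? n) * f (n ∸ (a + b)) ≡⟨ cong (λ s → 𝟙 (s ≤? n) * f (n ∸ s)) (+-comm a b) ⟩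
      𝟙 (b + a ≤? n) * f (n ∸ (b + a)) ≡⟨ term≡ b a ⟨
      term b a                         ∎

  countTuples-[] : ∀ n → countTuples [] n ≡ 𝟙 (n ≟ 0)
  countTuples-[] n with n ≟ 0
  ... | yes _ = refl
  ... | no _  = refl

  mutual
    countTuples-∷ : ∀ w ws n → countTuples (w ∷ ws) n ≡ sumOverMultiples w n (countTuples ws)
    countTuples-∷ w ws n = trans (cong sum (map-cong (countTuples-∷-term w ws n) (upTo (suc n)))) (sum-map-upTo (suc n) _)

    -- The left-hand side is the local function of countTuples, which cannot be named here.
    countTuples-∷-term : ∀ w ws n x → _ ≡ 𝟙 (w * x ≤? n) * countTuples ws (n ∸ w * x)
    countTuples-∷-term w ws n x with w * x ≤? n
    ... | yes _ = sym (+-identityʳ _)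
    ... | no _  = refl

  countTuples-∷ʳ : ∀ ws w n → All (1 ≤_) ws → 1 ≤ w →
    countTuples (ws ∷ʳ w) n ≡ sumOverMultiples w n (countTuples ws)
  countTuples-∷ʳ []       w n _          _   = countTuples-∷ w [] n
  countTuples-∷ʳ (v ∷ ws) w n (1≤v ∷ 1≤ws) 1≤w = begin
    countTuples (v ∷ (ws ∷ʳ w)) n                                ≡⟨ countTuples-∷ v (ws ∷ʳ w) n ⟩
    sumOverMultiples v n (countTuples (ws ∷ʳ w))                 ≡⟨ sumOverMultiples-cong v n (λ n′ → countTuples-∷ʳ ws w n′ 1≤ws 1≤w) ⟩
    sumOverMultiples v n (λ n′ → sumOverMultiples w n′ (countTuples ws)) ≡⟨ sumOverMultiples-comm v w n (countTuples ws) 1≤v 1≤w ⟩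
    sumOverMultiples w n (λ n′ → sumOverMultiples v n′ (countTuples ws)) ≡⟨ sumOverMultiples-cong w n (λ n′ → countTuples-∷ v ws n′) ⟨
    sumOverMultiples w n (countTuples (v ∷ ws))                  ∎

module Modulo (d : ℕ) .{{_ : NonZero d}} where

  open FiniteSums
  open import Data.Nat
  open import Data.Nat.Properties
  open import Data.Nat.DivMod
  open import Relation.Binary.PropositionalEquality
  open import Data.Nat.Divisibility using (_∣_; ∣-trans; %-presˡ-∣; ∣n∣m%n⇒∣m)
  open import Data.Nat.GCD using (gcd; gcd-universality; gcd-greatest; gcd[m,n]∣m; gcd[m,n]∣n; module Bézout)
  open import Data.Nat.Coprimality using (Coprime; coprime-Bézout)
  open import Data.Product using (Σ; _,_)
  open import Function using (_∘_)
  open import Relation.Nullary using (Dec; yes; no)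
  open import Data.Nat.Tactic.RingSolver using (solve-∀)
  open ≡-Reasoning

  %-cong-* : ∀ c {a b} → a % d ≡ b % d → (c * a) % d ≡ (c * b) % d
  %-cong-* c {a} {b} eq = trans (%-distribˡ-* c a d) (trans (cong (λ z → (c % d * z) % d) eq) (sym (%-distribˡ-* c b d)))

  ∑<-cong-% : ∀ n {f g : ℕ → ℕ} → (∀ x → x < n → f x % d ≡ g x % d) → ∑< n f % d ≡ ∑< n g % d
  ∑<-cong-% zero    eq = refl
  ∑<-cong-% (suc n) {f} {g} eq = begin
    (∑< n f + f n) % d             ≡⟨ %-distribˡ-+ (∑< n f) (f n) d ⟩
    (∑< n f % d + f n % d) % d     ≡⟨ cong₂ (λ a b → (a + b) % d) (∑<-cong-% n (λ x x<n → eq x (m<n⇒m<1+n x<n))) (eq n ≤-refl) ⟩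
    (∑< n g % d + g n % d) % d     ≡⟨ %-distribˡ-+ (∑< n g) (g n) d ⟨
    (∑< n g + g n) % d             ∎

  𝟙*-cong-% : ∀ {P : Set} (P? : Dec P) {a b} → (P → a % d ≡ b % d) → (𝟙 P? * a) % d ≡ (𝟙 P? * b) % d
  𝟙*-cong-% (yes p) eq = %-cong-* 1 (eq p)
  𝟙*-cong-% (no _)  _  = refl

  *≤⇒≤/ : ∀ N x → d * x ≤ N → x ≤ N / d
  *≤⇒≤/ N x dx≤N = subst (_≤ N / d) (m*n/n≡m x d) (/-monoˡ-≤ d (subst (_≤ N) (*-comm d x) dx≤N))

  ≤/⇒*≤ : ∀ N x → x ≤ N / d → d * x ≤ N
  ≤/⇒*≤ N x x≤q = ≤-trans (≤-reflexive (*-comm d x)) (≤-trans (*-monoˡ-≤ d x≤q) (m/n*n≤m N d))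

  count-multiples≤ : ∀ N → ∑< (suc N) (λ x → 𝟙 (d * x ≤? N)) ≡ suc (N / d)
  count-multiples≤ N = begin
    ∑< (suc N) (λ x → 𝟙 (d * x ≤? N))
      ≡⟨ ∑<-extend (suc (N / d)) (suc N) _ (s≤s (m/n≤m N d)) (λ x q<x → 𝟙-no (d * x ≤? N) (<⇒≱ q<x ∘ *≤⇒≤/ N x)) ⟩
    ∑< (suc (N / d)) (λ x → 𝟙 (d * x ≤? N))
      ≡⟨ ∑<-cong-< (suc (N / d)) (λ x x≤q → 𝟙-yes (d * x ≤? N) (≤/⇒*≤ N x (≤-pred x≤q))) ⟩
    ∑< (suc (N / d)) (λ _ → 1)                ≡⟨ ∑<-const (suc (N / d)) 1 ⟩
    suc (N / d) * 1                           ≡⟨ *-identityʳ _ ⟩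
    suc (N / d)                               ∎


  gcd-% : ∀ a → gcd (a % d) d ≡ gcd a d
  gcd-% a = gcd-universality
    (λ (c∣a , c∣d) → gcd-greatest (%-presˡ-∣ c∣a c∣d) c∣d)
    (λ c∣g → ∣n∣m%n⇒∣m (c∣d c∣g) (∣-trans c∣g (gcd[m,n]∣m (a % d) d)) , c∣d c∣g)
    where
    c∣d : ∀ {c} → c ∣ gcd (a % d) d → c ∣ d
    c∣d c∣g = ∣-trans c∣g (gcd[m,n]∣n (a % d) d)

  modular-inverse : ∀ u → Coprime u d → Σ ℕ (λ v → (u * v) % d ≡ 1 % d)
  modular-inverse u u⊥d with coprime-Bézout u⊥d
  ... | Bézout.+- x y 1+yd≡xu = x , (begin
    (u * x) % d         ≡⟨ cong (_% d) (trans (*-comm u x) (sym 1+yd≡xu)) ⟩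
    (1 + y * d) % d     ≡⟨ [m+kn]%n≡m%n 1 y d ⟩
    1 % d               ∎)
  -- Here u x ≡ -1 (mod d), so x (d - 1) is an inverse.
  ... | Bézout.-+ x y 1+xu≡yd = x * pred d , (begin
    (u * (x * pred d)) % d                   ≡⟨ [m+kn]%n≡m%n (u * (x * pred d)) 1 d ⟨
    (u * (x * pred d) + 1 * d) % d           ≡⟨ cong (_% d) (shift-by-d (pred d) (suc-pred d)) ⟩
    (1 + y * pred d * d) % d                 ≡⟨ [m+kn]%n≡m%n 1 (y * pred d) d ⟩
    1 % d                                    ∎)
    where
    shift-by-d : ∀ n → suc n ≡ d → u * (x * n) + 1 * d ≡ 1 + y * n * d
    shift-by-d n refl = begin
      u * (x * n) + 1 * suc n    ≡⟨ expand n x u ⟩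
      (1 + x * u) * n + 1        ≡⟨ cong (λ z → z * n + 1) 1+xu≡yd ⟩
      y * suc n * n + 1          ≡⟨ regroup y n ⟩
      1 + y * n * suc n          ∎
      where
      expand : ∀ n x u → u * (x * n) + 1 * suc n ≡ (1 + x * u) * n + 1
      expand = solve-∀
      regroup : ∀ y n → y * suc n * n + 1 ≡ 1 + y * n * suc n
      regroup = solve-∀

  linear-congruence-coprime : ∀ u c → Coprime u d → c < d → ∑< d (λ x → 𝟙 ((u * x) % d ≟ c)) ≡ 1
  linear-congruence-coprime u c u⊥d c<d = begin
    ∑< d (λ x → 𝟙 ((u * x) % d ≟ c))
      ≡⟨ ∑<-point d x₀ _ (m%n<n (v * c) d) (λ x x<d x≢x₀ → 𝟙-no ((u * x) % d ≟ c) (x≢x₀ ∘ root-unique x x<d)) ⟩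
    𝟙 ((u * x₀) % d ≟ c)               ≡⟨ 𝟙-yes ((u * x₀) % d ≟ c) root ⟩
    1                                  ∎
    where
    v = Σ.proj₁ (modular-inverse u u⊥d)
    inv : (u * v) % d ≡ 1 % d
    inv = Σ.proj₂ (modular-inverse u u⊥d)
    x₀ = (v * c) % d
    cancel : ∀ x → (u * v * x) % d ≡ x % d
    cancel x = trans (cong (_% d) (*-comm (u * v) x)) (trans (%-cong-* x inv) (cong (_% d) (*-identityʳ x)))
    root : (u * x₀) % d ≡ c
    root = begin
      (u * ((v * c) % d)) % d   ≡⟨ %-cong-* u (m%n%n≡m%n (v * c) d) ⟩
      (u * (v * c)) % d         ≡⟨ cong (_% d) (*-assoc u v c) ⟨
      (u * v * c) % d           ≡⟨ cancel c ⟩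
      c % d                     ≡⟨ m<n⇒m%n≡m c<d ⟩
      c                         ∎
    root-unique : ∀ x → x < d → (u * x) % d ≡ c → x ≡ x₀
    root-unique x x<d ux≡c = begin
      x                         ≡⟨ m<n⇒m%n≡m x<d ⟨
      x % d                     ≡⟨ cancel x ⟨
      (u * v * x) % d           ≡⟨ cong (_% d) (trans (cong (_* x) (*-comm u v)) (*-assoc v u x)) ⟩
      (v * (u * x)) % d         ≡⟨ %-cong-* v (trans ux≡c (sym (m<n⇒m%n≡m c<d))) ⟩
      (v * c) % d               ∎

module PartitionsModulo (m : ℕ) .{{_ : NonZero m}} where

  open FiniteSums
  open CountTuples
  open Modulo m
  open import Data.Nat
  open import Data.Nat.Properties
  open import Data.Nat.DivMod
  open import Data.Nat.Divisibility using (divides)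
  open import Data.List using (List; []; _∷_; _∷ʳ_; [_]; upTo; map)
  open import Data.List.Properties using (upTo-∷ʳ; map-++)
  open import Data.List.Relation.Unary.All using (All; []; _∷_)
  open import Relation.Binary.PropositionalEquality hiding ([_])
  open import Data.Nat.Tactic.RingSolver using (solve-∀)
  open ≡-Reasoning

  weights-suc : ∀ k → weights m (suc k) ≡ weights m k ∷ʳ m ^ k
  weights-suc k = trans (cong (map (m ^_)) (sym (upTo-∷ʳ k))) (map-++ (m ^_) (upTo k) [ k ])

  weights-positive : ∀ ks → All (1 ≤_) (map (m ^_) ks)
  weights-positive []       = []
  weights-positive (k ∷ ks) = m^n>0 m k ∷ weights-positive ks

  pM-suc : ∀ k n → pM m n (suc k) ≡ sumOverMultiples (m ^ k) n (λ n′ → pM m n′ k)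
  pM-suc k n = trans (cong (λ ws → countTuples ws n) (weights-suc k))
                     (countTuples-∷ʳ (weights m k) (m ^ k) n (weights-positive (upTo k)) (m^n>0 m k))

  pM-one : ∀ n → pM m n 1 ≡ 1
  pM-one n = begin
    pM m n 1                                  ≡⟨ pM-suc 0 n ⟩
    sumOverMultiples 1 n (λ n′ → pM m n′ 0)   ≡⟨ ∑<-point (suc n) n _ ≤-refl vanish ⟩
    𝟙 (1 * n ≤? n) * pM m (n ∸ 1 * n) 0
      ≡⟨ cong₂ _*_ (𝟙-yes (1 * n ≤? n) (≤-reflexive (*-identityˡ n))) (trans (countTuples-[] _) (𝟙-yes (_ ≟ 0) n∸1*n≡0)) ⟩
    1                                         ∎
    where
    n∸1*n≡0 : n ∸ 1 * n ≡ 0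
    n∸1*n≡0 = trans (cong (n ∸_) (*-identityˡ n)) (n∸n≡0 n)
    vanish : ∀ x → x < suc n → x ≢ n → 𝟙 (1 * x ≤? n) * pM m (n ∸ 1 * x) 0 ≡ 0
    vanish x x≤n x≢n = trans (cong (𝟙 (1 * x ≤? n) *_) (trans (countTuples-[] _) (𝟙-no (_ ≟ 0) n∸1*x≢0))) (*-zeroʳ (𝟙 (1 * x ≤? n)))
      where
      n∸1*x≢0 : n ∸ 1 * x ≢ 0
      n∸1*x≢0 eq = x≢n (≤-antisym (≤-pred x≤n) (m∸n≡0⇒m≤n (trans (cong (n ∸_) (sym (*-identityˡ x))) eq)))

  Periodic : ℕ → Set
  Periodic k = ∀ r b → pM m (r + b * m ^ k) k % m ≡ pM m r k % m

  module _ (k : ℕ) where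

    instance
      m^k≢0 : NonZero (m ^ k)
      m^k≢0 = m^n≢0 m k

    pM-suc-% : Periodic k → ∀ N →
      pM m N (suc k) % m ≡ (suc (N / m ^ k) * pM m (N % m ^ k) k) % m
    pM-suc-% periodic N = begin
      pM m N (suc k) % m                                             ≡⟨ cong (_% m) (pM-suc k N) ⟩
      ∑< (suc N) (λ x → 𝟙 (M * x ≤? N) * pM m (N ∸ M * x) k) % m     ≡⟨ ∑<-cong-% (suc N) (λ x _ → 𝟙*-cong-% (M * x ≤? N) (reduce x)) ⟩
      ∑< (suc N) (λ x → 𝟙 (M * x ≤? N) * pM m r k) % m               ≡⟨ cong (_% m) (∑<-*ʳ (suc N) (pM m r k) _) ⟩
      (∑< (suc N) (λ x → 𝟙 (M * x ≤? N)) * pM m r k) % m             ≡⟨ cong (λ c → (c * pM m r k) % m) (Modulo.count-multiples≤ M N) ⟩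
      (suc (N / M) * pM m r k) % m                                   ∎
      where
      M = m ^ k
      r = N % M
      reduce : ∀ x → M * x ≤ N → pM m (N ∸ M * x) k % m ≡ pM m r k % m
      reduce x Mx≤N = trans (cong (λ n → pM m n k % m) remainder) (periodic r (N / M ∸ x))
        where
        remainder : N ∸ M * x ≡ r + (N / M ∸ x) * M
        remainder = begin
          N ∸ M * x                     ≡⟨ cong₂ _∸_ (m≡m%n+[m/n]*n N M) (*-comm M x) ⟩
          r + N / M * M ∸ x * M         ≡⟨ +-∸-assoc r (*-monoˡ-≤ M (Modulo.*≤⇒≤/ M N x Mx≤N)) ⟩
          r + (N / M * M ∸ x * M)       ≡⟨ cong (r +_) (*-distribʳ-∸ M (N / M) x) ⟨
          r + (N / M ∸ x) * M           ∎

  pM-periodic : ∀ k → Periodic (suc k)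
  pM-periodic zero    r b = cong (_% m) (trans (pM-one (r + b * m ^ 1)) (sym (pM-one r)))
  pM-periodic (suc k) r b = begin
    pM m (r + b * m ^ suc (suc k)) (suc (suc k)) % m   ≡⟨ cong (λ n → pM m n (suc (suc k)) % m) (cong (r +_) (sym (*-assoc b m M))) ⟩
    pM m (r + b * m * M) (suc (suc k)) % m             ≡⟨ pM-suc-% (suc k) (pM-periodic k) (r + b * m * M) ⟩
    (suc ((r + b * m * M) / M) * p ((r + b * m * M) % M)) % m
      ≡⟨ cong₂ (λ q r′ → (suc q * p r′) % m) (+-distrib-/-∣ʳ r {d = M} (divides (b * m) refl)) ([m+kn]%n≡m%n r (b * m) M) ⟩
    (suc (r / M + b * m * M / M) * p (r % M)) % m      ≡⟨ cong (λ q → (suc (r / M + q) * p (r % M)) % m) (m*n/n≡m (b * m) M) ⟩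
    (suc (r / M + b * m) * p (r % M)) % m              ≡⟨ cong (_% m) (regroup (r / M) (p (r % M)) b m) ⟩
    (suc (r / M) * p (r % M) + b * p (r % M) * m) % m  ≡⟨ [m+kn]%n≡m%n (suc (r / M) * p (r % M)) (b * p (r % M)) m ⟩
    (suc (r / M) * p (r % M)) % m                      ≡⟨ pM-suc-% (suc k) (pM-periodic k) r ⟨
    pM m r (suc (suc k)) % m                           ∎
    where
    M = m ^ suc k
    instance
      M≢0 : NonZero M
      M≢0 = m^n≢0 m (suc k)
    p : ℕ → ℕ
    p n = pM m n (suc k)
    regroup : ∀ q x b m → suc (q + b * m) * x ≡ suc q * x + b * x * m
    regroup = solve-∀

  pM-block-% : ∀ k a r → r < m ^ suc k →
    pM m (a * m ^ suc k + r) (suc (suc k)) % m ≡ (suc a * pM m r (suc k)) % m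
  pM-block-% k a r r<M = begin
    pM m (a * M + r) (suc (suc k)) % m                               ≡⟨ pM-suc-% (suc k) (pM-periodic k) (a * M + r) ⟩
    (suc ((a * M + r) / M) * pM m ((a * M + r) % M) (suc k)) % m     ≡⟨ cong₂ (λ q r′ → (suc q * pM m r′ (suc k)) % m) quotient remainder ⟩
    (suc a * pM m r (suc k)) % m                                     ∎
    where
    M = m ^ suc k
    instance
      M≢0 : NonZero M
      M≢0 = m^n≢0 m (suc k)
    quotient : (a * M + r) / M ≡ a
    quotient = trans (+-distrib-/-∣ˡ r {d = M} (divides a refl)) (trans (cong₂ _+_ (m*n/n≡m a M) (m<n⇒m/n≡0 r<M)) (+-identityʳ a))
    remainder : (a * M + r) % M ≡ r
    remainder = trans (cong (_% M) (+-comm (a * M) r)) (trans ([m+kn]%n≡m%n r a M) (m<n⇒m%n≡m r<M))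

  residueCount : ℕ → ℕ → ℕ
  residueCount k c = ∑< (m ^ suc k) (λ n → 𝟙 (pM m n (suc k) % m ≟ c % m))

  -- productCount s c = #{(x₀, …, x_s) ∈ {0,…,m-1}^{s+1} : x₀ ⋯ x_s ≡ c (mod m)}
  productCount : ℕ → ℕ → ℕ
  productCount zero    c = 1
  productCount (suc s) c = ∑< m (λ u → ∑< m (λ x → 𝟙 ((u * x) % m ≟ c % m) * productCount s x))

  rM≡residueCount : ∀ i k → rM i m (suc k) ≡ residueCount k i
  rM≡residueCount i k = length-filter-upTo (λ n → pM m n (suc k) % m ≟ i % m) (m ^ suc k)

  residueCount-zero : ∀ c → residueCount 0 c ≡ m * 𝟙 (1 % m ≟ c % m)
  residueCount-zero c = begin
    ∑< (m * 1) (λ n → 𝟙 (pM m n 1 % m ≟ c % m))  ≡⟨ ∑<-cong (m * 1) (λ n → cong (λ p → 𝟙 (p % m ≟ c % m)) (pM-one n)) ⟩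
    ∑< (m * 1) (λ _ → 𝟙 (1 % m ≟ c % m))         ≡⟨ ∑<-const (m * 1) _ ⟩
    m * 1 * 𝟙 (1 % m ≟ c % m)                    ≡⟨ cong (_* 𝟙 (1 % m ≟ c % m)) (*-identityʳ m) ⟩
    m * 𝟙 (1 % m ≟ c % m)                        ∎

  -- n = a m^(k+1) + r contributes (a + 1) p(r) (mod m), and a + 1 runs over all residues 1, …, m.
  residueCount-suc : ∀ k c →
    residueCount (suc k) c ≡ ∑< m (λ u → ∑< m (λ y → 𝟙 ((u * y) % m ≟ c % m) * residueCount k y))
  residueCount-suc k c = begin
    ∑< (m * M) (λ n → 𝟙 (pM m n (suc (suc k)) % m ≟ c % m))
      ≡⟨ ∑<-blocks m M _ ⟩
    ∑< m (λ a → ∑< M (λ r → 𝟙 (pM m (a * M + r) (suc (suc k)) % m ≟ c % m)))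
      ≡⟨ ∑<-cong m (λ a → ∑<-cong-< M (λ r r<M → cong (λ z → 𝟙 (z ≟ c % m)) (pM-block-% k a r r<M))) ⟩
    ∑< m (λ a → ∑< M (λ r → 𝟙 ((suc a * p r) % m ≟ c % m)))
      ≡⟨ ∑<-cong m (λ a → by-residue (suc a)) ⟩
    ∑< m (λ a → H (suc a))
      ≡⟨ ∑<-rotate m H (∑<-cong m (λ y → cong (λ z → 𝟙 (z ≟ c % m) * residueCount k y) m*y%m≡0*y%m)) ⟩
    ∑< m H ∎
    where
    M = m ^ suc k
    p : ℕ → ℕ
    p n = pM m n (suc k)
    H : ℕ → ℕ
    H u = ∑< m (λ y → 𝟙 ((u * y) % m ≟ c % m) * residueCount k y)
    m*y%m≡0*y%m : ∀ {y} → (m * y) % m ≡ (0 * y) % m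
    m*y%m≡0*y%m {y} = trans (cong (_% m) (*-comm m y)) (trans (m*n%n≡0 y m) (sym (m*n%n≡0 0 m)))
    by-residue : ∀ u → ∑< M (λ r → 𝟙 ((u * p r) % m ≟ c % m)) ≡ H u
    by-residue u = begin
      ∑< M (λ r → 𝟙 ((u * p r) % m ≟ c % m))
        ≡⟨ ∑<-cong M (λ r → cong (λ z → 𝟙 (z ≟ c % m)) (%-cong-* u (sym (m%n%n≡m%n (p r) m)))) ⟩
      ∑< M (λ r → 𝟙 ((u * (p r % m)) % m ≟ c % m))
        ≡⟨ ∑<-fibres M m (λ r → p r % m) (λ y → 𝟙 ((u * y) % m ≟ c % m)) (λ r _ → m%n<n (p r) m) ⟩
      ∑< m (λ y → 𝟙 ((u * y) % m ≟ c % m) * ∑< M (λ r → 𝟙 (p r % m ≟ y)))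
        ≡⟨ ∑<-cong-< m (λ y y<m → cong (λ z → 𝟙 ((u * y) % m ≟ c % m) * ∑< M (λ r → 𝟙 (p r % m ≟ z))) (sym (m<n⇒m%n≡m y<m))) ⟩
      H u ∎

  residueCount≡m*productCount : ∀ s c → residueCount (suc s) c ≡ m * productCount s c
  residueCount≡m*productCount zero c = begin
    residueCount 1 c
      ≡⟨ residueCount-suc 0 c ⟩
    ∑< m (λ u → ∑< m (λ y → 𝟙 ((u * y) % m ≟ c % m) * residueCount 0 y))
      ≡⟨ ∑<-cong-< m only-y≡1 ⟩
    ∑< m (λ u → 𝟙 (u ≟ c % m) * m)
      ≡⟨ ∑<-point m (c % m) _ (m%n<n c m) (λ u _ u≢c → cong (_* m) (𝟙-no (u ≟ c % m) u≢c)) ⟩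
    𝟙 (c % m ≟ c % m) * m
      ≡⟨ cong (_* m) (𝟙-yes (c % m ≟ c % m) refl) ⟩
    1 * m
      ≡⟨ *-comm 1 m ⟩
    m * 1 ∎
    where
    only-y≡1 : ∀ u → u < m → ∑< m (λ y → 𝟙 ((u * y) % m ≟ c % m) * residueCount 0 y) ≡ 𝟙 (u ≟ c % m) * m
    only-y≡1 u u<m = begin
      ∑< m (λ y → 𝟙 ((u * y) % m ≟ c % m) * residueCount 0 y)  ≡⟨ ∑<-point m (1 % m) _ (m%n<n 1 m) vanish ⟩
      𝟙 ((u * (1 % m)) % m ≟ c % m) * residueCount 0 (1 % m)  ≡⟨ cong₂ (λ a b → 𝟙 (a ≟ c % m) * b) u*1%m≡u residueCount-one ⟩
      𝟙 (u ≟ c % m) * m                                       ∎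
      where
      vanish : ∀ y → y < m → y ≢ 1 % m → 𝟙 ((u * y) % m ≟ c % m) * residueCount 0 y ≡ 0
      vanish y y<m y≢1 = begin
        U * residueCount 0 y            ≡⟨ cong (U *_) (residueCount-zero y) ⟩
        U * (m * 𝟙 (1 % m ≟ y % m))     ≡⟨ cong (λ b → U * (m * b)) (𝟙-no (1 % m ≟ y % m) 1≢y) ⟩
        U * (m * 0)                     ≡⟨ cong (U *_) (*-zeroʳ m) ⟩
        U * 0                           ≡⟨ *-zeroʳ U ⟩
        0                               ∎
        where
        U = 𝟙 ((u * y) % m ≟ c % m)
        1≢y : 1 % m ≢ y % m
        1≢y eq = y≢1 (trans (sym (m<n⇒m%n≡m y<m)) (sym eq))
      residueCount-one : residueCount 0 (1 % m) ≡ m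
      residueCount-one = trans (residueCount-zero (1 % m)) (trans (cong (m *_) (𝟙-yes (1 % m ≟ 1 % m % m) (sym (m%n%n≡m%n 1 m)))) (*-identityʳ m))
      u*1%m≡u : (u * (1 % m)) % m ≡ u
      u*1%m≡u = trans (%-cong-* u (m%n%n≡m%n 1 m)) (trans (cong (_% m) (*-identityʳ u)) (m<n⇒m%n≡m u<m))
  residueCount≡m*productCount (suc s) c = begin
    residueCount (suc (suc s)) c
      ≡⟨ residueCount-suc (suc s) c ⟩
    ∑< m (λ u → ∑< m (λ y → U u y * residueCount (suc s) y))
      ≡⟨ ∑<-cong m (λ u → ∑<-cong m (λ y → cong (U u y *_) (residueCount≡m*productCount s y))) ⟩
    ∑< m (λ u → ∑< m (λ y → U u y * (m * productCount s y)))
      ≡⟨ ∑<-cong m (λ u → ∑<-cong m (λ y → x*[m*y]≡m*[x*y] (U u y) m (productCount s y))) ⟩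
    ∑< m (λ u → ∑< m (λ y → m * (U u y * productCount s y)))
      ≡⟨ ∑<-cong m (λ u → ∑<-*ˡ m m _) ⟩
    ∑< m (λ u → m * ∑< m (λ y → U u y * productCount s y))
      ≡⟨ ∑<-*ˡ m m _ ⟩
    m * productCount (suc s) c ∎
    where
    U : ℕ → ℕ → ℕ
    U u y = 𝟙 ((u * y) % m ≟ c % m)
    x*[m*y]≡m*[x*y] : ∀ x m y → x * (m * y) ≡ m * (x * y)
    x*[m*y]≡m*[x*y] = solve-∀

  rM≡m*productCount : ∀ i s → rM i m (suc (suc s)) ≡ m * productCount s i
  rM≡m*productCount i s = trans (rM≡residueCount i (suc s)) (residueCount≡m*productCount s i)

module DivisorSums where

  open FiniteSums
  open import Data.Nat
  open import Data.Nat.Properties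
  open import Data.Nat.Divisibility
  open import Data.Nat.DivMod using (_/_; m*n/n≡m)
  open import Data.Nat.Primality using (Prime; euclidsLemma; prime⇒nonZero; prime⇒irreducible; prime⇒nonTrivial)
  open import Data.Nat.Combinatorics using (_C_; nCn≡1; nCk+nC[k+1]≡[n+1]C[k+1])
  open import Data.Nat.Coprimality using (Coprime; coprime-divisor)
  open import Data.Product using (_×_; _,_; proj₁; proj₂)
  open import Data.Sum using (inj₁; inj₂)
  open import Data.List using (List; []; _∷_; map)
  open import Data.Nat.ListAction using (product)
  open import Data.List.Relation.Unary.All using (All; []; _∷_)
  open import Data.List.Relation.Unary.AllPairs using ([]; _∷_)
  open import Data.List.Relation.Unary.Unique.Propositional using (Unique)
  open import Relation.Binary.PropositionalEquality hiding (J)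
  open import Relation.Nullary using (yes; no; ¬_)
  open import Data.Empty using (⊥-elim)
  open import Function using (_∘_)
  open import Data.Nat.Tactic.RingSolver using (solve-∀)
  open ≡-Reasoning

  -- Division with the junk value J ÷ 0 = 0, so that no NonZero instance is needed.
  infixl 7 _÷_
  _÷_ : ℕ → ℕ → ℕ
  J ÷ zero  = 0
  J ÷ suc d = J / suc d

  ÷-exact : ∀ {d e J} → 0 < d → d * e ≡ J → J ÷ d ≡ e
  ÷-exact {suc d} {e} _ refl = trans (cong (_/ suc d) (*-comm (suc d) e)) (m*n/n≡m e (suc d))

  divisor-pos : ∀ {d J} → 0 < J → d ∣ J → 0 < d
  divisor-pos {zero}  0<J (divides q eq) = ⊥-elim (<⇒≢ 0<J (sym (trans eq (*-zeroʳ q))))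
  divisor-pos {suc _} _   _              = z<s

  𝟙∣-beyond : ∀ {d J} → 0 < J → J < d → 𝟙 (d ∣? J) ≡ 0
  𝟙∣-beyond {J = suc _} _ J<d = 𝟙-no (_ ∣? _) (λ d∣J → <⇒≱ J<d (∣⇒≤ d∣J))

  divisorSum : ℕ → (ℕ → ℕ → ℕ) → ℕ
  divisorSum J H = ∑< (suc J) (λ d → 𝟙 (d ∣? J) * H d (J ÷ d))

  divisorSum-cong : ∀ J {H H′ : ℕ → ℕ → ℕ} → (∀ d e → H d e ≡ H′ d e) → divisorSum J H ≡ divisorSum J H′
  divisorSum-cong J eq = ∑<-cong (suc J) (λ d → cong (𝟙 (d ∣? J) *_) (eq d (J ÷ d)))

  divisorSum-extend : ∀ J N (H : ℕ → ℕ → ℕ) → 0 < J → J ≤ N → ∑< (suc N) (λ d → 𝟙 (d ∣? J) * H d (J ÷ d)) ≡ divisorSum J H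
  divisorSum-extend J N H 0<J J≤N =
    ∑<-extend (suc J) (suc N) _ (s≤s J≤N) (λ d J<d → cong (_* H d (J ÷ d)) (𝟙∣-beyond 0<J J<d))

  divisorSum-multiples : ∀ p J′ J (H : ℕ → ℕ → ℕ) → 0 < p → 0 < J′ → p * J′ ≡ J →
    ∑< (suc J) (λ d → 𝟙 (p ∣? d) * (𝟙 (d ∣? J) * H d (J ÷ d))) ≡ divisorSum J′ (λ w → H (p * w))
  divisorSum-multiples p J′ J H 0<p 0<J′ refl = begin
    ∑< (suc J) T                                   ≡⟨ ∑<-extend (suc J) (suc J′ * p) T J<1+J′*p beyond ⟨
    ∑< (suc J′ * p) T                              ≡⟨ ∑<-blocks (suc J′) p T ⟩
    ∑< (suc J′) (λ w → ∑< p (λ r → T (w * p + r))) ≡⟨ ∑<-cong (suc J′) (λ w → trans (block w) (multiple w)) ⟩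
    divisorSum J′ (λ w → H (p * w))                ∎
    where
    T : ℕ → ℕ
    T d = 𝟙 (p ∣? d) * (𝟙 (d ∣? J) * H d (J ÷ d))
    0<J : 0 < J
    0<J = *-mono-< 0<p 0<J′
    beyond : ∀ d → J < d → T d ≡ 0
    beyond d J<d = trans (cong (λ z → 𝟙 (p ∣? d) * (z * H d (J ÷ d))) (𝟙∣-beyond 0<J J<d)) (*-zeroʳ (𝟙 (p ∣? d)))
    J<1+J′*p : suc J ≤ suc J′ * p
    J<1+J′*p = subst (λ z → suc z ≤ suc J′ * p) (*-comm J′ p) (+-monoˡ-≤ (J′ * p) 0<p)
    block : ∀ w → ∑< p (λ r → T (w * p + r)) ≡ T (w * p)
    block w = trans (∑<-point p 0 _ 0<p off-multiple) (cong T (+-identityʳ (w * p)))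
      where
      remainder : ∀ r → r < p → p ∣ w * p + r → r ≡ 0
      remainder zero    _   _ = refl
      remainder (suc r) r<p p∣ = ⊥-elim (<⇒≱ r<p (∣⇒≤ (∣m+n∣m⇒∣n p∣ (n∣m*n w))))
      off-multiple : ∀ r → r < p → r ≢ 0 → T (w * p + r) ≡ 0
      off-multiple r r<p r≢0 = cong (_* (𝟙 (w * p + r ∣? J) * H (w * p + r) (J ÷ (w * p + r))))
                                    (𝟙-no (p ∣? w * p + r) (r≢0 ∘ remainder r r<p))
    multiple : ∀ w → T (w * p) ≡ 𝟙 (w ∣? J′) * H (p * w) (J′ ÷ w)
    multiple w with w ∣? J′
    ... | yes w∣J′@(divides q J′≡q*w) = begin
      𝟙 (p ∣? w * p) * (𝟙 (w * p ∣? J) * H (w * p) (J ÷ (w * p)))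
        ≡⟨ cong₂ (λ a b → a * (b * H (w * p) (J ÷ (w * p)))) (𝟙-yes (p ∣? w * p) (n∣m*n w)) (𝟙-yes (w * p ∣? J) (divides q J≡q*wp)) ⟩
      1 * (1 * H (w * p) (J ÷ (w * p)))           ≡⟨ trans (*-identityˡ _) (*-identityˡ _) ⟩
      H (w * p) (J ÷ (w * p))                     ≡⟨ cong₂ H (*-comm w p) (trans (÷-exact 0<wp wp*q≡J) (sym (÷-exact 0<w w*q≡J′))) ⟩
      H (p * w) (J′ ÷ w)                          ≡⟨ *-identityˡ _ ⟨
      1 * H (p * w) (J′ ÷ w)                      ∎
      where
      0<w : 0 < w
      0<w = divisor-pos 0<J′ w∣J′
      0<wp : 0 < w * p
      0<wp = *-mono-< 0<w 0<p
      J≡q*wp : J ≡ q * (w * p)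
      J≡q*wp = trans (cong (p *_) J′≡q*w) (reassociate p q w)
        where
        reassociate : ∀ p q w → p * (q * w) ≡ q * (w * p)
        reassociate = solve-∀
      w*q≡J′ : w * q ≡ J′
      w*q≡J′ = trans (*-comm w q) (sym J′≡q*w)
      wp*q≡J : w * p * q ≡ J
      wp*q≡J = trans (*-comm (w * p) q) (sym J≡q*wp)
    ... | no w∤J′ = trans (cong (λ b → 𝟙 (p ∣? w * p) * (b * H (w * p) (J ÷ (w * p)))) (𝟙-no (w * p ∣? J) wp∤J)) (*-zeroʳ (𝟙 (p ∣? w * p)))
      where
      wp∤J : ¬ w * p ∣ J
      wp∤J wp∣J = w∤J′ (*-cancelˡ-∣ p {{>-nonZero 0<p}} (subst (_∣ J) (*-comm w p) wp∣J))

  prime-pos : ∀ {p} → Prime p → 0 < p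
  prime-pos pp = >-nonZero⁻¹ _ {{prime⇒nonZero pp}}

  prime≢1 : ∀ {p} → Prime p → p ≢ 1
  prime≢1 pp = nonTrivial⇒≢1 {{prime⇒nonTrivial pp}}

  prime∤⇒coprime : ∀ {p d} → Prime p → ¬ p ∣ d → Coprime d p
  prime∤⇒coprime pp p∤d (c∣d , c∣p) with prime⇒irreducible pp c∣p
  ... | inj₁ c≡1 = c≡1
  ... | inj₂ refl = ⊥-elim (p∤d c∣d)

  ∣p^k*n⇒∣n : ∀ {p d} k n → Prime p → ¬ p ∣ d → d ∣ p ^ k * n → d ∣ n
  ∣p^k*n⇒∣n zero    n pp p∤d d∣ = subst (_ ∣_) (*-identityˡ n) d∣
  ∣p^k*n⇒∣n {p} {d} (suc k) n pp p∤d d∣ =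
    ∣p^k*n⇒∣n k n pp p∤d (coprime-divisor (prime∤⇒coprime pp p∤d) (subst (d ∣_) (*-assoc p (p ^ k) n) d∣))

  module _ {p R : ℕ} (pp : Prime p) (p∤R : ¬ p ∣ R) (0<R : 0 < R) where

    private instance
      p≢0 : NonZero p
      p≢0 = prime⇒nonZero pp

    𝟙∣-split : ∀ k (H : ℕ → ℕ → ℕ) d → 𝟙 (d ∣? p ^ k * R) * H d (p ^ k * R ÷ d)
      ≡ 𝟙 (d ∣? R) * H d (p ^ k * (R ÷ d)) + 𝟙 (p ∣? d) * (𝟙 (d ∣? p ^ k * R) * H d (p ^ k * R ÷ d))
    𝟙∣-split k H d with p ∣? d
    ... | yes p∣d = sym (cong₂ _+_ (cong (_* H d (p ^ k * (R ÷ d))) (𝟙-no (d ∣? R) (p∤R ∘ ∣-trans p∣d))) (*-identityˡ _))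
    ... | no p∤d with d ∣? R
    ...   | yes d∣R@(divides q R≡q*d) = begin
      𝟙 (d ∣? p ^ k * R) * H d (p ^ k * R ÷ d)     ≡⟨ cong₂ _*_ (𝟙-yes (d ∣? p ^ k * R) (∣n⇒∣m*n (p ^ k) d∣R)) (cong (H d) cofactor≡) ⟩
      1 * H d (p ^ k * (R ÷ d))                    ≡⟨ +-identityʳ _ ⟨
      1 * H d (p ^ k * (R ÷ d)) + 0                ∎
      where
      0<d : 0 < d
      0<d = divisor-pos 0<R d∣R
      d*[p^k*q]≡p^k*R : d * (p ^ k * q) ≡ p ^ k * R
      d*[p^k*q]≡p^k*R = trans (regroup d (p ^ k) q) (cong (p ^ k *_) (sym R≡q*d))
        where
        regroup : ∀ d a q → d * (a * q) ≡ a * (q * d)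
        regroup = solve-∀
      cofactor≡ : p ^ k * R ÷ d ≡ p ^ k * (R ÷ d)
      cofactor≡ = trans (÷-exact 0<d d*[p^k*q]≡p^k*R) (cong (p ^ k *_) (sym (÷-exact 0<d (trans (*-comm d q) (sym R≡q*d)))))
    ...   | no d∤R = cong (_* H d (p ^ k * R ÷ d)) (𝟙-no (d ∣? p ^ k * R) (d∤R ∘ ∣p^k*n⇒∣n k R pp p∤d))

    divisorSum-prime-power* : ∀ α (H : ℕ → ℕ → ℕ) →
      divisorSum (p ^ α * R) H ≡ ∑< (suc α) (λ β → divisorSum R (λ d e → H (p ^ β * d) (p ^ (α ∸ β) * e)))
    divisorSum-prime-power* zero H = begin
      divisorSum (1 * R) H                          ≡⟨ cong (λ J → divisorSum J H) (*-identityˡ R) ⟩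
      divisorSum R H                                ≡⟨ divisorSum-cong R (λ d e → cong₂ H (sym (*-identityˡ d)) (sym (*-identityˡ e))) ⟩
      divisorSum R (λ d e → H (1 * d) (1 * e))      ∎
    divisorSum-prime-power* (suc α) H = begin
      divisorSum J H
        ≡⟨ ∑<-cong (suc J) (𝟙∣-split (suc α) H) ⟩
      ∑< (suc J) (λ d → T₁ d + T₂ d)
        ≡⟨ ∑<-distrib-+ (suc J) T₁ T₂ ⟩
      ∑< (suc J) T₁ + ∑< (suc J) T₂
        ≡⟨ cong₂ _+_ (divisorSum-extend R J (λ d e → H d (p ^ suc α * e)) 0<R R≤J) (divisorSum-multiples p J′ J H 0<p 0<J′ p*J′≡J) ⟩
      divisorSum R (λ d e → H d (p ^ suc α * e)) + divisorSum J′ (λ w → H (p * w))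
        ≡⟨ cong₂ _+_ (divisorSum-cong R (λ d e → cong (λ x → H x (p ^ suc α * e)) (sym (*-identityˡ d))))
                     (divisorSum-prime-power* α (λ w → H (p * w))) ⟩
      divisorSum R (λ d e → H (1 * d) (p ^ suc α * e))
        + ∑< (suc α) (λ β → divisorSum R (λ d e → H (p * (p ^ β * d)) (p ^ (α ∸ β) * e)))
        ≡⟨ cong (divisorSum R (λ d e → H (1 * d) (p ^ suc α * e)) +_)
                (∑<-cong (suc α) (λ β → divisorSum-cong R (λ d e → cong (λ x → H x (p ^ (α ∸ β) * e)) (sym (*-assoc p (p ^ β) d))))) ⟩
      divisorSum R (λ d e → H (1 * d) (p ^ suc α * e))
        + ∑< (suc α) (λ β → divisorSum R (λ d e → H (p ^ suc β * d) (p ^ (α ∸ β) * e)))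
        ≡⟨ ∑<-suc (suc α) _ ⟨
      ∑< (suc (suc α)) (λ β → divisorSum R (λ d e → H (p ^ β * d) (p ^ (suc α ∸ β) * e))) ∎
      where
      J  = p ^ suc α * R
      J′ = p ^ α * R
      T₁ T₂ : ℕ → ℕ
      T₁ d = 𝟙 (d ∣? R) * H d (p ^ suc α * (R ÷ d))
      T₂ d = 𝟙 (p ∣? d) * (𝟙 (d ∣? J) * H d (J ÷ d))
      0<p : 0 < p
      0<p = prime-pos pp
      0<J′ : 0 < J′
      0<J′ = *-mono-< (m^n>0 p α) 0<R
      p*J′≡J : p * J′ ≡ J
      p*J′≡J = sym (*-assoc p (p ^ α) R)
      R≤J : R ≤ J
      R≤J = m≤n*m R (p ^ suc α) ⦃ m^n≢0 p (suc α) ⦄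

  prodPow : List (ℕ × ℕ) → ℕ
  prodPow fs = product (map (λ pa → proj₁ pa ^ proj₂ pa) fs)

  DistinctPrimes : List (ℕ × ℕ) → Set
  DistinctPrimes fs = All Prime (map proj₁ fs) × Unique (map proj₁ fs)

  -- Sum over the divisors d = ∏ pᵢ^βᵢ (βᵢ ≤ αᵢ) of prodPow fs, each paired with the
  -- factorisation of its cofactor, ∏ pᵢ^(αᵢ ∸ βᵢ).
  ∑splittings : List (ℕ × ℕ) → (ℕ → List (ℕ × ℕ) → ℕ) → ℕ
  ∑splittings []             H = H 1 []
  ∑splittings ((p , α) ∷ fs) H = ∑< (suc α) (λ β → ∑splittings fs (λ d fs′ → H (p ^ β * d) ((p , α ∸ β) ∷ fs′)))

  prime∣p^k⇒≡ : ∀ {p q} k → Prime p → Prime q → p ∣ q ^ k → p ≡ q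
  prime∣p^k⇒≡ zero pp pq p∣1 = ⊥-elim (prime≢1 pp (∣1⇒≡1 p∣1))
  prime∣p^k⇒≡ {p} {q} (suc k) pp pq p∣q^k+1 with euclidsLemma q (q ^ k) pp p∣q^k+1
  ... | inj₂ p∣q^k = prime∣p^k⇒≡ k pp pq p∣q^k
  ... | inj₁ p∣q with prime⇒irreducible pq p∣q
  ...   | inj₁ p≡1 = ⊥-elim (prime≢1 pp p≡1)
  ...   | inj₂ p≡q = p≡q

  prime∤prodPow : ∀ {p} fs → Prime p → All Prime (map proj₁ fs) → All (p ≢_) (map proj₁ fs) → ¬ p ∣ prodPow fs
  prime∤prodPow []             pp _          _            p∣1 = prime≢1 pp (∣1⇒≡1 p∣1)
  prime∤prodPow ((q , β) ∷ fs) pp (pq ∷ pfs) (p≢q ∷ p∉fs) p∣ with euclidsLemma (q ^ β) (prodPow fs) pp p∣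
  ... | inj₁ p∣q^β = p≢q (prime∣p^k⇒≡ β pp pq p∣q^β)
  ... | inj₂ p∣fs  = prime∤prodPow fs pp pfs p∉fs p∣fs

  prodPow-pos : ∀ fs → All Prime (map proj₁ fs) → 0 < prodPow fs
  prodPow-pos []             _          = z<s
  prodPow-pos ((q , β) ∷ fs) (pq ∷ pfs) = *-mono-< (m^n>0 q ⦃ prime⇒nonZero pq ⦄ β) (prodPow-pos fs pfs)

  divisorSum-prodPow : ∀ fs → DistinctPrimes fs → ∀ H →
    divisorSum (prodPow fs) H ≡ ∑splittings fs (λ d fs′ → H d (prodPow fs′))
  divisorSum-prodPow []             _                           H = +-identityʳ (H 1 1)
  divisorSum-prodPow ((p , α) ∷ fs) (pp ∷ pfs , p∉fs ∷ unique) H = begin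
    divisorSum (p ^ α * prodPow fs) H
      ≡⟨ divisorSum-prime-power* pp (prime∤prodPow fs pp pfs p∉fs) (prodPow-pos fs pfs) α H ⟩
    ∑< (suc α) (λ β → divisorSum (prodPow fs) (λ d e → H (p ^ β * d) (p ^ (α ∸ β) * e)))
      ≡⟨ ∑<-cong (suc α) (λ β → divisorSum-prodPow fs (pfs , unique) (λ d e → H (p ^ β * d) (p ^ (α ∸ β) * e))) ⟩
    ∑splittings ((p , α) ∷ fs) (λ d fs′ → H d (prodPow fs′)) ∎

  ∑splittings-cong : ∀ fs {H H′ : ℕ → List (ℕ × ℕ) → ℕ} →
    (∀ d fs′ → map proj₁ fs′ ≡ map proj₁ fs → d * prodPow fs′ ≡ prodPow fs → H d fs′ ≡ H′ d fs′) →
    ∑splittings fs H ≡ ∑splittings fs H′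
  ∑splittings-cong []             eq = eq 1 [] refl refl
  ∑splittings-cong ((p , α) ∷ fs) eq = ∑<-cong-< (suc α) (λ β β≤α → ∑splittings-cong fs (λ d fs′ same d*fs′≡fs →
    eq (p ^ β * d) ((p , α ∸ β) ∷ fs′) (cong (p ∷_) same) (begin
      p ^ β * d * (p ^ (α ∸ β) * prodPow fs′)   ≡⟨ [m*n]*[o*p]≡[m*o]*[n*p] (p ^ β) d (p ^ (α ∸ β)) (prodPow fs′) ⟩
      p ^ β * p ^ (α ∸ β) * (d * prodPow fs′)   ≡⟨ cong₂ _*_ (^-distribˡ-+-* p β (α ∸ β)) (sym d*fs′≡fs) ⟨
      p ^ (β + (α ∸ β)) * prodPow fs            ≡⟨ cong (λ k → p ^ k * prodPow fs) (m+[n∸m]≡n (≤-pred β≤α)) ⟩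
      p ^ α * prodPow fs                        ∎)))

  ∑splittings-*ˡ : ∀ fs c (H : ℕ → List (ℕ × ℕ) → ℕ) → ∑splittings fs (λ d fs′ → c * H d fs′) ≡ c * ∑splittings fs H
  ∑splittings-*ˡ []             c H = refl
  ∑splittings-*ˡ ((p , α) ∷ fs) c H = trans (∑<-cong (suc α) (λ β → ∑splittings-*ˡ fs c _)) (∑<-*ˡ (suc α) c _)

  hockey-stick : ∀ α s → ∑< (suc α) (λ γ → (γ + s) C γ) ≡ (α + suc s) C α
  hockey-stick zero    s = refl
  hockey-stick (suc α) s = begin
    ∑< (suc α) (λ γ → (γ + s) C γ) + (suc α + s) C suc α  ≡⟨ cong₂ _+_ (hockey-stick α s) (cong (_C suc α) (sym (+-suc α s))) ⟩
    (α + suc s) C α + (α + suc s) C suc α                 ≡⟨ nCk+nC[k+1]≡[n+1]C[k+1] (α + suc s) α ⟩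
    suc (α + suc s) C suc α                               ∎

  binomialProduct : ℕ → List (ℕ × ℕ) → ℕ
  binomialProduct s fs = product (map (λ pa → (proj₂ pa + s) C proj₂ pa) fs)

  binomialProduct-zero : ∀ fs → binomialProduct 0 fs ≡ 1
  binomialProduct-zero []             = refl
  binomialProduct-zero ((p , α) ∷ fs) = cong₂ _*_ (trans (cong (_C α) (+-identityʳ α)) (nCn≡1 α)) (binomialProduct-zero fs)

  ∑splittings-binomialProduct : ∀ fs s → ∑splittings fs (λ _ fs′ → binomialProduct s fs′) ≡ binomialProduct (suc s) fs
  ∑splittings-binomialProduct []             s = refl
  ∑splittings-binomialProduct ((p , α) ∷ fs) s = begin
    ∑< (suc α) (λ β → ∑splittings fs (λ _ fs′ → ((α ∸ β + s) C (α ∸ β)) * binomialProduct s fs′))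
      ≡⟨ ∑<-cong (suc α) (λ β → trans (∑splittings-*ˡ fs ((α ∸ β + s) C (α ∸ β)) (λ _ fs′ → binomialProduct s fs′))
                                      (cong (((α ∸ β + s) C (α ∸ β)) *_) (∑splittings-binomialProduct fs s))) ⟩
    ∑< (suc α) (λ β → ((α ∸ β + s) C (α ∸ β)) * binomialProduct (suc s) fs)
      ≡⟨ ∑<-*ʳ (suc α) (binomialProduct (suc s) fs) _ ⟩
    ∑< (suc α) (λ β → (α ∸ β + s) C (α ∸ β)) * binomialProduct (suc s) fs
      ≡⟨ cong (_* binomialProduct (suc s) fs) (trans (∑<-reverse α (λ γ → (γ + s) C γ)) (hockey-stick α s)) ⟩
    ((α + suc s) C α) * binomialProduct (suc s) fs ∎

module GcdLemmas where

  open import Data.Nat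
  open import Data.Nat.Properties
  open import Data.Nat.Divisibility
  open import Data.Nat.GCD
  open import Data.Nat.Coprimality using (Coprime; coprime-divisor; gcd≡1⇒coprime)
  open import Data.Product using (_,_; proj₁)
  open import Relation.Binary.PropositionalEquality
  open ≡-Reasoning

  coprime-∣ʳ : ∀ {x n d} → Coprime x n → d ∣ n → Coprime x d
  coprime-∣ʳ x⊥n d∣n (c∣x , c∣d) = x⊥n (c∣x , ∣-trans c∣d d∣n)

  gcd-*-coprimeˡ : ∀ {a n} y → Coprime a n → gcd (a * y) n ≡ gcd y n
  gcd-*-coprimeˡ {a} {n} y a⊥n = sym (gcd-universality
    (λ (c∣ay , c∣n) → gcd-greatest (coprime-divisor (λ (e∣c , e∣a) → a⊥n (e∣a , ∣-trans e∣c c∣n)) c∣ay) c∣n)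
    (λ c∣g → ∣n⇒∣m*n a (∣-trans c∣g (gcd[m,n]∣m y n)) , ∣-trans c∣g (gcd[m,n]∣n y n)))

  gcd-*-*ˡ : ∀ k a b → gcd (k * a) (k * b) ≡ k * gcd a b
  gcd-*-*ˡ k a b = sym (c*gcd[m,n]≡gcd[cm,cn] k a b)

  gcd-*-*≡⇒coprime : ∀ {k a b} → 0 < k → gcd (k * a) (k * b) ≡ k → Coprime a b
  gcd-*-*≡⇒coprime {k} {a} {b} 0<k g≡k =
    gcd≡1⇒coprime (*-cancelˡ-≡ (gcd a b) 1 k ⦃ >-nonZero 0<k ⦄ (trans (sym (gcd-*-*ˡ k a b)) (trans g≡k (sym (*-identityʳ k)))))

  gcd-quotients-coprime : ∀ a b {a′ b′} → 0 < gcd a b → a ≡ a′ * gcd a b → b ≡ b′ * gcd a b → Coprime a′ b′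
  gcd-quotients-coprime a b {a′} {b′} 0<g a≡ b≡ = gcd-*-*≡⇒coprime 0<g (begin
    gcd (g * a′) (g * b′) ≡⟨ cong₂ gcd (trans (*-comm g a′) (sym a≡)) (trans (*-comm g b′) (sym b≡)) ⟩
    gcd a b               ∎)
    where g = gcd a b

  ∣⇒gcd≡ : ∀ {J n} → J ∣ n → gcd J n ≡ J
  ∣⇒gcd≡ J∣n = sym (gcd-universality proj₁ (λ c∣J → c∣J , ∣-trans c∣J J∣n))

module ProductCounts (m : ℕ) .{{_ : NonZero m}} where

  open FiniteSums
  open Modulo m
  open GcdLemmas
  open DivisorSums using (_÷_; ÷-exact; divisor-pos; divisorSum; divisorSum-extend; prodPow; DistinctPrimes; divisorSum-prodPow;
                          ∑splittings; ∑splittings-cong; ∑splittings-*ˡ; binomialProduct; binomialProduct-zero; ∑splittings-binomialProduct)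
  open PartitionsModulo m using (productCount)
  open import Data.Nat
  open import Data.Nat.Properties
  open import Data.Nat.DivMod
  open import Data.Nat.Divisibility
  open import Data.Nat.GCD
  open import Data.Nat.Coprimality using (Coprime; gcd≡1⇒coprime; coprime⇒gcd≡1)
  open import Data.Product using (_×_)
  open import Data.Nat.Primality using (Prime)
  open import Data.List.Relation.Unary.All using (All)
  open import Data.List.Relation.Unary.Unique.Propositional using (Unique)
  open import Data.Empty using (⊥-elim)
  open import Function using (_∘_)
  open import Relation.Binary.PropositionalEquality
  open import Relation.Nullary using (yes; no)
  open import Data.Nat.Tactic.RingSolver using (solve-∀)
  open ≡-Reasoning

  0<m : 0 < m
  0<m = >-nonZero⁻¹ m

  0<gcd : ∀ u → 0 < gcd u m
  0<gcd u = divisor-pos 0<m (gcd[m,n]∣n u m)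

  congruence⇒gcd∣ : ∀ {u x c} → (u * x) % m ≡ c % m → gcd u m ∣ c
  congruence⇒gcd∣ {u} {x} {c} ux≡c = ∣n∣m%n⇒∣m (gcd[m,n]∣n u m)
    (subst (gcd u m ∣_) ux≡c (%-presˡ-∣ (∣m⇒∣m*n x (gcd[m,n]∣m u m)) (gcd[m,n]∣n u m)))

  linear-congruence-count : ∀ u c → gcd u m ∣ c → ∑< m (λ x → 𝟙 ((u * x) % m ≟ c % m)) ≡ gcd u m
  linear-congruence-count u c g∣c = begin
    ∑< m (λ x → 𝟙 ((u * x) % m ≟ c % m))   ≡⟨ ∑<-cong m reduced ⟩
    ∑< m f                                 ≡⟨ cong (λ n → ∑< n f) (trans m≡m′g (*-comm m′ g)) ⟩
    ∑< (g * m′) f                          ≡⟨ ∑<-periodic g m′ f periodic ⟩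
    g * ∑< m′ f                            ≡⟨ cong (g *_) (Modulo.linear-congruence-coprime m′ u′ c′ u′⊥m′ c′<m′) ⟩
    g * 1                                  ≡⟨ *-identityʳ g ⟩
    g                                      ∎
    where
    g = gcd u m
    m′ = quotient (gcd[m,n]∣n u m)
    m≡m′g : m ≡ m′ * g
    m≡m′g = m∣n⇒n≡quotient*m (gcd[m,n]∣n u m)
    u′ = quotient (gcd[m,n]∣m u m)
    u≡u′g : u ≡ u′ * g
    u≡u′g = m∣n⇒n≡quotient*m (gcd[m,n]∣m u m)
    c′ = quotient (%-presˡ-∣ g∣c (gcd[m,n]∣n u m))
    c%m≡c′g : c % m ≡ c′ * g
    c%m≡c′g = m∣n⇒n≡quotient*m (%-presˡ-∣ g∣c (gcd[m,n]∣n u m))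
    instance
      m′≢0 : NonZero m′
      m′≢0 = quotient≢0 (gcd[m,n]∣n u m)
      m′g≢0 : NonZero (m′ * g)
      m′g≢0 = >-nonZero (subst (0 <_) m≡m′g 0<m)
    u′⊥m′ : Coprime u′ m′
    u′⊥m′ = gcd-quotients-coprime u m (0<gcd u) u≡u′g m≡m′g
    c′<m′ : c′ < m′
    c′<m′ = *-cancelʳ-< g c′ m′ (subst₂ _<_ c%m≡c′g m≡m′g (m%n<n c m))
    f : ℕ → ℕ
    f x = 𝟙 ((u′ * x) % m′ ≟ c′)
    scaled : ∀ x → (u * x) % m ≡ ((u′ * x) % m′) * g
    scaled x = begin
      (u * x) % m             ≡⟨ cong (_% m) (trans (cong (_* x) u≡u′g) (swap u′ g x)) ⟩
      (u′ * x * g) % m        ≡⟨ %-congʳ m≡m′g ⟩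
      (u′ * x * g) % (m′ * g) ≡⟨ m%n*o≡m*o%[n*o] (u′ * x) m′ g ⟨
      (u′ * x) % m′ * g       ∎
      where
      swap : ∀ a b x → a * b * x ≡ a * x * b
      swap = solve-∀
    reduced : ∀ x → 𝟙 ((u * x) % m ≟ c % m) ≡ f x
    reduced x = 𝟙-cong ((u * x) % m ≟ c % m) ((u′ * x) % m′ ≟ c′)
      (λ eq → *-cancelʳ-≡ _ _ g ⦃ >-nonZero (0<gcd u) ⦄ (trans (sym (scaled x)) (trans eq c%m≡c′g)))
      (λ eq → trans (scaled x) (trans (cong (_* g) eq) (sym c%m≡c′g)))
    periodic : ∀ k r → r < m′ → f (k * m′ + r) ≡ f r
    periodic k r _ = cong (λ z → 𝟙 (z ≟ c′)) (trans (cong (_% m′) (distribute u′ k m′ r)) ([m+kn]%n≡m%n (u′ * r) (u′ * k) m′))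
      where
      distribute : ∀ u k m r → u * (k * m + r) ≡ u * r + u * k * m
      distribute = solve-∀

  -- m = J · cofactor with every prime factor of m dividing the cofactor, i.e. J · rad J ∣ m;
  -- the condition on primes is stated as a coprimality transfer.
  record FullCofactor (J : ℕ) : Set where
    field
      cofactor     : ℕ
      J*cofactor≡m : J * cofactor ≡ m
      coprime-lift : ∀ {x} → Coprime x cofactor → Coprime x m

  module _ {J : ℕ} (J⊣ : FullCofactor J) where

    open FullCofactor J⊣

    fullCofactor⇒∣ : J ∣ m
    fullCofactor⇒∣ = divides cofactor (trans (sym J*cofactor≡m) (*-comm J cofactor))

    fullCofactor-pos : 0 < J
    fullCofactor-pos = divisor-pos 0<m fullCofactor⇒∣

    fullCofactor-∣ : ∀ d e → d * e ≡ J → FullCofactor e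
    fullCofactor-∣ d e d*e≡J = record
      { cofactor     = d * cofactor
      ; J*cofactor≡m = trans (x*[y*z]≡y*x*z e d cofactor) (trans (cong (_* cofactor) d*e≡J) J*cofactor≡m)
      ; coprime-lift = λ x⊥dq → coprime-lift (coprime-∣ʳ x⊥dq (n∣m*n d))
      }
      where
      x*[y*z]≡y*x*z : ∀ x y z → x * (y * z) ≡ y * x * z
      x*[y*z]≡y*x*z = solve-∀

  gcd-lift : ∀ {J q x} → 0 < J → J ∣ m → (∀ {y} → Coprime y q → Coprime y m) → gcd x (J * q) ≡ J → gcd x m ≡ J
  gcd-lift {J} {q} {x} 0<J J∣m lift gcd≡J = begin
    gcd x m                 ≡⟨ cong₂ gcd (trans x≡x″J (*-comm x″ J)) (trans m≡MJ (*-comm M J)) ⟩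
    gcd (J * x″) (J * M)    ≡⟨ gcd-*-*ˡ J x″ M ⟩
    J * gcd x″ M            ≡⟨ cong (J *_) (coprime⇒gcd≡1 x″⊥M) ⟩
    J * 1                   ≡⟨ *-identityʳ J ⟩
    J                       ∎
    where
    J∣x : J ∣ x
    J∣x = subst (_∣ x) gcd≡J (gcd[m,n]∣m x (J * q))
    x″ = quotient J∣x
    x≡x″J : x ≡ x″ * J
    x≡x″J = m∣n⇒n≡quotient*m J∣x
    M = quotient J∣m
    m≡MJ : m ≡ M * J
    m≡MJ = m∣n⇒n≡quotient*m J∣m
    x″⊥q : Coprime x″ q
    x″⊥q = gcd-*-*≡⇒coprime 0<J (trans (cong (λ z → gcd z (J * q)) (trans (*-comm J x″) (sym x≡x″J))) gcd≡J)
    x″⊥M : Coprime x″ M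
    x″⊥M = coprime-∣ʳ (lift x″⊥q) (divides J (trans m≡MJ (*-comm M J)))

  solution-gcd : ∀ {J c u x J′} → FullCofactor J → gcd c m ≡ J → gcd u m * J′ ≡ J → (u * x) % m ≡ c % m → gcd x m ≡ J′
  solution-gcd {J} {c} {u} {x} {J′} J⊣ gcd[c,m]≡J gJ′≡J ux≡c =
    gcd-lift {x = x} (divisor-pos (fullCofactor-pos J⊣) (divides g (sym gJ′≡J)))
             (fullCofactor⇒∣ (fullCofactor-∣ J⊣ g J′ gJ′≡J)) coprime-lift
             (*-cancelˡ-≡ (gcd x (J′ * q)) J′ g ⦃ >-nonZero (0<gcd u) ⦄ (begin
      g * gcd x (J′ * q)      ≡⟨ gcd-*-*ˡ g x (J′ * q) ⟨
      gcd (g * x) (g * (J′ * q)) ≡⟨ cong (gcd (g * x)) (trans (sym (*-assoc g J′ q)) (trans (cong (_* q) gJ′≡J) J*cofactor≡m)) ⟩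
      gcd (g * x) m           ≡⟨ gcd-*-coprimeˡ (g * x) u′⊥m ⟨
      gcd (u′ * (g * x)) m    ≡⟨ cong (λ z → gcd z m) (trans (sym (*-assoc u′ g x)) (cong (_* x) (sym u≡u′g))) ⟩
      gcd (u * x) m           ≡⟨ gcd-% (u * x) ⟨
      gcd ((u * x) % m) m     ≡⟨ cong (λ z → gcd z m) ux≡c ⟩
      gcd (c % m) m           ≡⟨ gcd-% c ⟩
      gcd c m                 ≡⟨ trans gcd[c,m]≡J (sym gJ′≡J) ⟩
      g * J′                  ∎))
    where
    open FullCofactor J⊣ renaming (cofactor to q)
    g = gcd u m
    m′ = quotient (gcd[m,n]∣n u m)
    m≡m′g : m ≡ m′ * g
    m≡m′g = m∣n⇒n≡quotient*m (gcd[m,n]∣n u m)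
    u′ = quotient (gcd[m,n]∣m u m)
    u≡u′g : u ≡ u′ * g
    u≡u′g = m∣n⇒n≡quotient*m (gcd[m,n]∣m u m)
    m′≡J′q : m′ ≡ J′ * q
    m′≡J′q = *-cancelʳ-≡ m′ (J′ * q) g ⦃ >-nonZero (0<gcd u) ⦄ (begin
      m′ * g        ≡⟨ sym m≡m′g ⟩
      m             ≡⟨ sym J*cofactor≡m ⟩
      J * q         ≡⟨ cong (_* q) (sym gJ′≡J) ⟩
      g * J′ * q    ≡⟨ x*y*z≡y*z*x g J′ q ⟩
      J′ * q * g    ∎)
      where
      x*y*z≡y*z*x : ∀ x y z → x * y * z ≡ y * z * x
      x*y*z≡y*z*x = solve-∀
    u′⊥m : Coprime u′ m
    u′⊥m = coprime-lift (coprime-∣ʳ (gcd-quotients-coprime u m (0<gcd u) u≡u′g m≡m′g) (divides J′ m′≡J′q))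

  φ≡∑coprime : φ m ≡ ∑< m (λ w → 𝟙 (gcd w m ≟ 1))
  φ≡∑coprime = trans (length-filter-upTo (λ j → gcd (suc j) m ≟ 1) m)
                     (∑<-rotate m (λ w → 𝟙 (gcd w m ≟ 1)) (cong (λ z → 𝟙 (z ≟ 1)) (trans (∣⇒gcd≡ ∣-refl) (sym (gcd-identityˡ m)))))

  count-gcd≡ : ∀ d M → d * M ≡ m → ∑< m (λ u → 𝟙 (gcd u m ≟ d)) ≡ ∑< M (λ w → 𝟙 (gcd w M ≟ 1))
  count-gcd≡ d M dM≡m = begin
    ∑< m f                                        ≡⟨ cong (λ n → ∑< n f) (trans (sym dM≡m) (*-comm d M)) ⟩
    ∑< (M * d) f                                  ≡⟨ ∑<-blocks M d f ⟩
    ∑< M (λ w → ∑< d (λ r → f (w * d + r)))       ≡⟨ ∑<-cong M (λ w → trans (block w) (multiple w)) ⟩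
    ∑< M (λ w → 𝟙 (gcd w M ≟ 1))                  ∎
    where
    f : ℕ → ℕ
    f u = 𝟙 (gcd u m ≟ d)
    0<d : 0 < d
    0<d = divisor-pos 0<m (divides M (trans (sym dM≡m) (*-comm d M)))
    block : ∀ w → ∑< d (λ r → f (w * d + r)) ≡ f (w * d)
    block w = trans (∑<-point d 0 _ 0<d (λ r r<d r≢0 → 𝟙-no (gcd (w * d + r) m ≟ d) (r≢0 ∘ remainder r r<d)))
                    (cong f (+-identityʳ (w * d)))
      where
      remainder : ∀ r → r < d → gcd (w * d + r) m ≡ d → r ≡ 0
      remainder zero    _   _      = refl
      remainder (suc r) r<d gcd≡d = ⊥-elim (<⇒≱ r<d (∣⇒≤ (∣m+n∣m⇒∣n d∣wd+r (n∣m*n w))))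
        where
        d∣wd+r : d ∣ w * d + suc r
        d∣wd+r = subst (_∣ w * d + suc r) gcd≡d (gcd[m,n]∣m (w * d + suc r) m)
    multiple : ∀ w → f (w * d) ≡ 𝟙 (gcd w M ≟ 1)
    multiple w = 𝟙-cong (gcd (w * d) m ≟ d) (gcd w M ≟ 1)
      (λ gcd≡d → *-cancelˡ-≡ (gcd w M) 1 d ⦃ >-nonZero 0<d ⦄ (trans (sym scaled) (trans gcd≡d (sym (*-identityʳ d)))))
      (λ gcd≡1 → trans scaled (trans (cong (d *_) gcd≡1) (*-identityʳ d)))
      where
      scaled : gcd (w * d) m ≡ d * gcd w M
      scaled = trans (cong₂ gcd (*-comm w d) (sym dM≡m)) (gcd-*-*ˡ d w M)

  gcd-fibre-count : ∀ {d} → FullCofactor d → d * ∑< m (λ u → 𝟙 (gcd u m ≟ d)) ≡ φ m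
  gcd-fibre-count {d} d⊣ = begin
    d * ∑< m (λ u → 𝟙 (gcd u m ≟ d))   ≡⟨ cong (d *_) (count-gcd≡ d M J*cofactor≡m) ⟩
    d * ∑< M f                         ≡⟨ ∑<-periodic d M f periodic ⟨
    ∑< (d * M) f                       ≡⟨ cong (λ n → ∑< n f) J*cofactor≡m ⟩
    ∑< m f                             ≡⟨ ∑<-cong m same-coprimality ⟨
    ∑< m (λ w → 𝟙 (gcd w m ≟ 1))       ≡⟨ φ≡∑coprime ⟨
    φ m                                ∎
    where
    open FullCofactor d⊣ renaming (cofactor to M)
    instance
      M≢0 : NonZero M
      M≢0 = >-nonZero (divisor-pos 0<m (divides d (sym J*cofactor≡m)))
    f : ℕ → ℕ
    f w = 𝟙 (gcd w M ≟ 1)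
    same-coprimality : ∀ w → 𝟙 (gcd w m ≟ 1) ≡ f w
    same-coprimality w = 𝟙-cong (gcd w m ≟ 1) (gcd w M ≟ 1)
      (λ gcd≡1 → coprime⇒gcd≡1 (coprime-∣ʳ (gcd≡1⇒coprime {w} gcd≡1) (divides d (sym J*cofactor≡m))))
      (λ gcd≡1 → coprime⇒gcd≡1 (coprime-lift (gcd≡1⇒coprime {w} gcd≡1)))
    periodic : ∀ k r → r < M → f (k * M + r) ≡ f r
    periodic k r _ = cong (λ z → 𝟙 (z ≟ 1)) (begin
      gcd (k * M + r) M             ≡⟨ Modulo.gcd-% M (k * M + r) ⟨
      gcd ((k * M + r) % M) M       ≡⟨ cong (λ z → gcd z M) (trans (cong (_% M) (+-comm (k * M) r)) ([m+kn]%n≡m%n r k M)) ⟩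
      gcd (r % M) M                 ≡⟨ Modulo.gcd-% M r ⟩
      gcd r M                       ∎)

  gcdWeight : ℕ → ℕ → ℕ → ℕ
  gcdWeight s J g = 𝟙 (g ∣? J) * (g * productCount s (J ÷ g))

  GcdInvariant : ℕ → Set
  GcdInvariant s = ∀ {J x} → FullCofactor J → gcd x m ≡ J → productCount s x ≡ productCount s J

  weighted-solutions : ∀ s → GcdInvariant s → ∀ {J c} u → FullCofactor J → gcd c m ≡ J →
    ∑< m (λ x → 𝟙 ((u * x) % m ≟ c % m) * productCount s x) ≡ gcdWeight s J (gcd u m)
  weighted-solutions s invariant {J} {c} u J⊣ gcd[c,m]≡J with gcd u m ∣? J
  ... | no g∤J = ∑<-≡0 m (λ x _ → cong (_* productCount s x) (𝟙-no ((u * x) % m ≟ c % m) (g∤J ∘ g∣J)))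
    where
    g∣J : ∀ {x} → (u * x) % m ≡ c % m → gcd u m ∣ J
    g∣J {x} ux≡c = subst (gcd u m ∣_) gcd[c,m]≡J (gcd-greatest (congruence⇒gcd∣ {u} {x} ux≡c) (gcd[m,n]∣n u m))
  ... | yes g∣J@(divides J′ J≡J′g) = begin
    ∑< m (λ x → 𝟙 ((u * x) % m ≟ c % m) * productCount s x)
      ≡⟨ ∑<-cong m (λ x → 𝟙*-cong ((u * x) % m ≟ c % m) (invariant J′⊣ ∘ solution-gcd {u = u} {x = x} J⊣ gcd[c,m]≡J gJ′≡J)) ⟩
    ∑< m (λ x → 𝟙 ((u * x) % m ≟ c % m) * productCount s J′)
      ≡⟨ ∑<-*ʳ m (productCount s J′) _ ⟩
    ∑< m (λ x → 𝟙 ((u * x) % m ≟ c % m)) * productCount s J′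
      ≡⟨ cong (_* productCount s J′) (linear-congruence-count u c (∣-trans g∣J (subst (_∣ c) gcd[c,m]≡J (gcd[m,n]∣m c m)))) ⟩
    g * productCount s J′
      ≡⟨ cong (λ e → g * productCount s e) (÷-exact (0<gcd u) gJ′≡J) ⟨
    g * productCount s (J ÷ g)
      ≡⟨ *-identityˡ _ ⟨
    1 * (g * productCount s (J ÷ g)) ∎
    where
    g = gcd u m
    gJ′≡J : g * J′ ≡ J
    gJ′≡J = trans (*-comm g J′) (sym J≡J′g)
    J′⊣ : FullCofactor J′
    J′⊣ = fullCofactor-∣ J⊣ g J′ gJ′≡J

  productCount-suc : ∀ s → GcdInvariant s → ∀ {J c} → FullCofactor J → gcd c m ≡ J →
    productCount (suc s) c ≡ ∑< m (λ u → gcdWeight s J (gcd u m))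
  productCount-suc s invariant J⊣ gcd[c,m]≡J = ∑<-cong m (λ u → weighted-solutions s invariant u J⊣ gcd[c,m]≡J)

  productCount-gcdInvariant : ∀ s → GcdInvariant s
  productCount-gcdInvariant zero    _  _ = refl
  productCount-gcdInvariant (suc s) J⊣ gcd[x,m]≡J =
    trans (productCount-suc s (productCount-gcdInvariant s) J⊣ gcd[x,m]≡J)
          (sym (productCount-suc s (productCount-gcdInvariant s) J⊣ (∣⇒gcd≡ (fullCofactor⇒∣ J⊣))))

  productCount-suc-divisorSum : ∀ s {J} → FullCofactor J →
    productCount (suc s) J ≡ φ m * divisorSum J (λ _ e → productCount s e)
  productCount-suc-divisorSum s {J} J⊣ = begin
    productCount (suc s) J
      ≡⟨ productCount-suc s (productCount-gcdInvariant s) J⊣ (∣⇒gcd≡ (fullCofactor⇒∣ J⊣)) ⟩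
    ∑< m (λ u → gcdWeight s J (gcd u m))
      ≡⟨ ∑<-fibres m (suc m) (λ u → gcd u m) (gcdWeight s J) (λ u _ → s≤s (gcd[m,n]≤n u m)) ⟩
    ∑< (suc m) (λ g → gcdWeight s J g * ∑< m (λ u → 𝟙 (gcd u m ≟ g)))
      ≡⟨ ∑<-cong (suc m) by-divisor ⟩
    ∑< (suc m) (λ g → φ m * (𝟙 (g ∣? J) * productCount s (J ÷ g)))
      ≡⟨ ∑<-*ˡ (suc m) (φ m) _ ⟩
    φ m * ∑< (suc m) (λ g → 𝟙 (g ∣? J) * productCount s (J ÷ g))
      ≡⟨ cong (φ m *_) (divisorSum-extend J m (λ _ e → productCount s e) (fullCofactor-pos J⊣) (∣⇒≤ (fullCofactor⇒∣ J⊣))) ⟩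
    φ m * divisorSum J (λ _ e → productCount s e) ∎
    where
    by-divisor : ∀ g → gcdWeight s J g * ∑< m (λ u → 𝟙 (gcd u m ≟ g)) ≡ φ m * (𝟙 (g ∣? J) * productCount s (J ÷ g))
    by-divisor g with g ∣? J
    ... | no _ = sym (*-zeroʳ (φ m))
    ... | yes (divides e J≡eg) = begin
      1 * (g * P) * N  ≡⟨ cong (_* N) (*-identityˡ (g * P)) ⟩
      g * P * N        ≡⟨ x*y*z≡y*[x*z] g P N ⟩
      P * (g * N)      ≡⟨ cong (P *_) (gcd-fibre-count (fullCofactor-∣ J⊣ e g (sym J≡eg))) ⟩
      P * φ m          ≡⟨ *-comm P (φ m) ⟩
      φ m * P          ≡⟨ cong (φ m *_) (*-identityˡ P) ⟨
      φ m * (1 * P)    ∎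
      where
      P = productCount s (J ÷ g)
      N = ∑< m (λ u → 𝟙 (gcd u m ≟ g))
      x*y*z≡y*[x*z] : ∀ x y z → x * y * z ≡ y * (x * z)
      x*y*z≡y*[x*z] = solve-∀

  productCount-prodPow : ∀ s fs → DistinctPrimes fs → FullCofactor (prodPow fs) →
    productCount s (prodPow fs) ≡ φ m ^ s * binomialProduct s fs
  productCount-prodPow zero    fs _      _  = sym (trans (*-identityˡ _) (binomialProduct-zero fs))
  productCount-prodPow (suc s) fs primes J⊣ = begin
    productCount (suc s) (prodPow fs)
      ≡⟨ productCount-suc-divisorSum s J⊣ ⟩
    φ m * divisorSum (prodPow fs) (λ _ e → productCount s e)
      ≡⟨ cong (φ m *_) (divisorSum-prodPow fs primes (λ _ e → productCount s e)) ⟩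
    φ m * ∑splittings fs (λ _ fs′ → productCount s (prodPow fs′))
      ≡⟨ cong (φ m *_) (∑splittings-cong fs (λ d fs′ same d*fs′≡fs →
           productCount-prodPow s fs′ (subst (λ ps → All Prime ps × Unique ps) (sym same) primes) (fullCofactor-∣ J⊣ d (prodPow fs′) d*fs′≡fs))) ⟩
    φ m * ∑splittings fs (λ _ fs′ → φ m ^ s * binomialProduct s fs′)
      ≡⟨ cong (φ m *_) (∑splittings-*ˡ fs (φ m ^ s) (λ _ fs′ → binomialProduct s fs′)) ⟩
    φ m * (φ m ^ s * ∑splittings fs (λ _ fs′ → binomialProduct s fs′))
      ≡⟨ cong (λ b → φ m * (φ m ^ s * b)) (∑splittings-binomialProduct fs s) ⟩
    φ m * (φ m ^ s * binomialProduct (suc s) fs)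
      ≡⟨ *-assoc (φ m) (φ m ^ s) _ ⟨
    φ m ^ suc s * binomialProduct (suc s) fs ∎

module Radical where

  open import Data.Nat
  open import Data.Nat.Properties using (_≟_; *-comm; *-assoc)
  open import Data.Nat.Divisibility
  open import Data.Nat.Primality using (Prime; prime?; euclidsLemma)
  open import Data.Nat.Primality.Factorisation using (factorise; PrimeFactorisation)
  open import Data.Nat.Coprimality using (Coprime)
  open import Data.Nat.ListAction using (product)
  open import Data.Nat.ListAction.Properties using (∈⇒∣product)
  open import Data.List using ([]; _∷_)
  open import Data.List.Relation.Unary.All using (_∷_)
  open import Data.List.Membership.Propositional.Properties using (∈-filter⁺; ∈-upTo⁺)
  open import Data.Product using (_,_)
  open import Data.Sum using (inj₁; inj₂)
  open import Data.Empty using (⊥; ⊥-elim)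
  open import Relation.Binary.PropositionalEquality
  open import Relation.Nullary using (yes; no)
  open import Relation.Nullary.Decidable using (_×-dec_)
  open DivisorSums using (divisor-pos; prime≢1)

  no-common-prime⇒coprime : ∀ {a b} → 0 < b → (∀ {p} → Prime p → p ∣ a → p ∣ b → ⊥) → Coprime a b
  no-common-prime⇒coprime {a} {b} 0<b no-common {c} (c∣a , c∣b) with c ≟ 1
  ... | yes c≡1 = c≡1
  ... | no c≢1  = ⊥-elim (prime-factor (factorise c ⦃ >-nonZero (divisor-pos 0<b c∣b) ⦄))
    where
    prime-factor : PrimeFactorisation c → ⊥
    prime-factor record { factors = [] ; isFactorisation = c≡1 } = c≢1 c≡1
    prime-factor record { factors = p ∷ ps ; isFactorisation = c≡p*ps ; factorsPrime = pp ∷ _ } =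
      no-common pp (∣-trans p∣c c∣a) (∣-trans p∣c c∣b)
      where
      p∣c : p ∣ c
      p∣c = subst (p ∣_) (sym c≡p*ps) (m∣m*n (product ps))

  ∣⇒∣rad : ∀ {p i} → 1 ≤ i → Prime p → p ∣ i → p ∣ rad i
  ∣⇒∣rad {p} {i@(suc _)} _ pp p∣i =
    ∈⇒∣product (∈-filter⁺ (λ q → prime? q ×-dec (q ∣? i)) (∈-upTo⁺ (s≤s (∣⇒≤ p∣i))) (pp , p∣i))

  fullCofactor-rad : ∀ i m .{{_ : NonZero m}} → 1 ≤ i → i * rad i ∣ m → ProductCounts.FullCofactor m i
  fullCofactor-rad i m 1≤i (divides t m≡t*[i*rad]) = record
    { cofactor     = q
    ; J*cofactor≡m = sym m≡i*q
    ; coprime-lift = λ x⊥q → no-common-prime⇒coprime (>-nonZero⁻¹ m) (λ pp p∣x p∣m → prime≢1 pp (x⊥q (p∣x , p∣q pp p∣m)))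
    }
    where
    q = t * rad i
    m≡i*q : m ≡ i * q
    m≡i*q = trans m≡t*[i*rad] (trans (cong (t *_) (*-comm i (rad i))) (trans (sym (*-assoc t (rad i) i)) (*-comm q i)))
    p∣q : ∀ {p} → Prime p → p ∣ m → p ∣ q
    p∣q pp p∣m with euclidsLemma i q pp (subst (_ ∣_) m≡i*q p∣m)
    ... | inj₁ p∣i = ∣-trans (∣⇒∣rad 1≤i pp p∣i) (n∣m*n t)
    ... | inj₂ p∣q = p∣q

open import Data.Nat using (suc; s≤s; z≤n)
open import Data.Nat.Properties using (*-assoc)
open import Data.Product using (_,_)
open import Data.List.Relation.Unary.All.Properties using (map⁺)
open import Relation.Binary.PropositionalEquality using (refl; cong; module ≡-Reasoning)
open DivisorSums using (prodPow; binomialProduct)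
open ProductCounts using (productCount-prodPow)
open Radical using (fullCofactor-rad)

theorem6p15 : (i k m : ℕ) → .{{_ : NonZero m}} → 1 ≤ i → 2 ≤ k → i * rad i ∣ m →
    (fs : List (ℕ × ℕ)) → 1 ≤ length fs →
    All (λ pa → Prime (proj₁ pa)) fs → Unique (map proj₁ fs) →
    All (λ pa → 1 ≤ proj₂ pa) fs →
    i ≡ product (map (λ pa → proj₁ pa ^ proj₂ pa) fs) →
    rM i m k ≡ m * (φ m ^ (k ∸ 2)) * product (map (λ pa → (proj₂ pa + (k ∸ 2)) C proj₂ pa) fs)
theorem6p15 i (suc (suc s)) m 1≤i (s≤s (s≤s z≤n)) i*rad∣m fs _ primes unique _ refl = begin
  rM (prodPow fs) m (suc (suc s))                ≡⟨ rM≡m*productCount (prodPow fs) s ⟩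
  m * productCount s (prodPow fs)                ≡⟨ cong (m *_) (productCount-prodPow m s fs (map⁺ primes , unique) (fullCofactor-rad i m 1≤i i*rad∣m)) ⟩
  m * (φ m ^ s * binomialProduct s fs)           ≡⟨ *-assoc m (φ m ^ s) (binomialProduct s fs) ⟨
  m * φ m ^ s * binomialProduct s fs             ∎
  where
  open PartitionsModulo m using (productCount; rM≡m*productCount)
  open ≡-Reasoning
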